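{- Let $m\ge 5$ and let $\pi=(d_1,\ldots,d_{2m+1})\in GS_{2m+1}$ satisfy $d_i=m$ for $2\le i\le m+2$ and $d_{2m+1-i}=i+1$ for $1\le i\le m-2$. If either $d_{2m+1}=2$ and $d_1\ge m+1$, or $d_{2m+1}=1$ and $d_1=m$, then $\pi$ has a realization containing $C_3,\ldots,C_{2m}$ on those vertices with degrees $d_1,\ldots,d_{2m}$.
   Context: A sequence of nonnegative integers is graphic if it is the degree sequence of a simple graph $G$ (a realization). $GS_n$ denotes the set of graphic sequences $(d_1,\ldots,d_n)$ with $d_1\ge\cdots\ge d_n\ge 0$ and $d_1\le n-1$. "$\pi$ has a realization containing $C_3,\ldots,C_k$ on those vertices with degrees $d_1,\ldots,d_k$" means: there is a realization $G$ of $\pi$ and distinct vertices $v_1,\ldots,v_k$ of $G$ with $\deg_G(v_j)=d_j$ for $1\le j\le k$ such that, for every $r$ with $3\le r\le k$, the subgraph of $G$ induced by $\{v_1,\ldots,v_k\}$ contains a cycle of length $r$. -}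

module Defs where

open import Data.Nat using (ℕ; zero; suc; _+_; _≤_; _<_; _∸_; _<?_)
open import Data.Bool using (Bool; true; false; if_then_else_)
open import Data.Fin using (Fin; toℕ; fromℕ<) renaming (_≤_ to _≤ᶠ_)
open import Data.List using (map; allFin)
open import Data.Nat.ListAction using (sum)
open import Data.Product using (Σ; ∃; _×_; _,_)
open import Relation.Binary.PropositionalEquality using (_≡_)
open import Relation.Nullary using (yes; no)
open import Function.Definitions using (Injective)

record SimpleGraph (n : ℕ) : Set where
  field
    adj    : Fin n → Fin n → Bool
    sym    : ∀ u v → adj u v ≡ adj v u
    irrefl : ∀ v → adj v v ≡ false

open SimpleGraph public

Adj : ∀ {n} → SimpleGraph n → Fin n → Fin n → Set
Adj G u v = adj G u v ≡ true

deg : ∀ {n} → SimpleGraph n → Fin n → ℕ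
deg {n} G v = sum (map (λ u → if adj G v u then 1 else 0) (allFin n))

-- A degree sequence of length n: d i is the degree prescribed for the
-- (toℕ i + 1)-th entry.  G realizes d when vertex i has degree d i.
IsRealization : ∀ {n} → SimpleGraph n → (Fin n → ℕ) → Set
IsRealization G d = ∀ i → deg G i ≡ d i

Graphic : ∀ {n} → (Fin n → ℕ) → Set
Graphic {n} d = Σ (SimpleGraph n) λ G → IsRealization G d

InGS : (n : ℕ) → (Fin n → ℕ) → Set
InGS n d = Graphic d
         × (∀ (i j : Fin n) → i ≤ᶠ j → d j ≤ d i)
         × (∀ (i : Fin n) → d i ≤ n ∸ 1)

-- 1-based indexing: d at j = d_j for 1 ≤ j ≤ n (0 outside that range)
_at_ : ∀ {n} → (Fin n → ℕ) → ℕ → ℕ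
_at_ d zero = 0
_at_ {n} d (suc j) with j <? n
... | yes p = d (fromℕ< p)
... | no _ = 0

HasCycleIn : ∀ {n} → SimpleGraph n → (Fin n → Set) → ℕ → Set
HasCycleIn {n} G S r =
  Σ (Fin r → Fin n) λ c →
      Injective _≡_ _≡_ c
    × (∀ i → S (c i))
    × (∀ (i j : Fin r) → suc (toℕ i) ≡ toℕ j → Adj G (c i) (c j))
    × (∀ (i j : Fin r) → toℕ i ≡ r ∸ 1 → toℕ j ≡ 0 → Adj G (c i) (c j))

HasCyclesOnFirst : ∀ {n} → (Fin n → ℕ) → ℕ → Set
HasCyclesOnFirst {n} d k =
  Σ (SimpleGraph n) λ G → IsRealization G d ×
  Σ (Fin k → Fin n) λ v →
      Injective _≡_ _≡_ v
    × (∀ (j : Fin k) → deg G (v j) ≡ d at suc (toℕ j))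
    × (∀ (r : ℕ) → 3 ≤ r → r ≤ k → HasCycleIn G (λ u → ∃ λ j → v j ≡ u) r)

module Submission where

-- Label the vertices 0, …, 2m, vertex u carrying d_{u+1}. In the threshold graph u ~ v ⇔ u + v ≤ 2m a
-- vertex u ≤ m has degree 2m − u and a vertex u > m has degree 2m + 1 − u, which is already d_{u+1} for
-- m < u < 2m. Deleting the pairs {u, v} ⊆ [1, m] with u + v ≤ m brings every u ∈ [1, m] down to m, or to
-- m + 1 when 2u ≤ m, i.e. u ≤ h = ⌊m/2⌋; that surplus edge goes to the apex 0 (for p < u ≤ h) or to the
-- token partner m + p + 1 − u (for u ≤ p). The apex also drops its edges into (m + p, m + k], k = p + a,
-- so every vertex of (m, m + k] has lost one edge, which a matching of (m, m + k] gives back (closed up by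
-- 2m when k is odd). The apex then has degree 2m − (h − p) − a, tuned to d_1 by taking p = 0 or a = 0; the
-- last vertex has degree 1 or 2 and agrees with d_{2m+1} because both degree sums are even. Finally
-- 0, 2m − 1, 1, 2m − 2, … is a Hamiltonian path of the first 2m vertices along edges of sum 2m − 1 and 2m,
-- and every cycle length 3, …, 2m is a segment of it closed by a chord.

open import Data.Bool using (Bool; if_then_else_)
open import Data.Empty using (⊥-elim)
open import Data.Fin using (Fin; toℕ; zero; suc; inject₁; fromℕ; fromℕ<)
import Data.Fin.Properties as Fin
open import Data.Fin.Properties
  using (toℕ-fromℕ<; toℕ-inject₁; toℕ-injective; toℕ<n; toℕ-fromℕ; inject₁-injective)
open import Data.List using (map; allFin; tabulate)
open import Data.List.Properties using (map-tabulate)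
open import Data.Nat
open import Data.Nat.Divisibility using (_∣_; m∣m*n; ∣m+n∣m⇒∣n; ∣1⇒≡1)
open import Data.Nat.ListAction using () renaming (sum to listSum)
open import Data.Nat.Properties
open import Algebra.Properties.CommutativeMonoid.Sum +-0-commutativeMonoid
  using (sum; ∑-distrib-+; ∑-comm; sum-cong-≗; sum-init-last)
open import Algebra.Properties.CommutativeSemigroup +-commutativeSemigroup using (xy∙z≈xz∙y)
open import Data.Nat.Tactic.RingSolver using (solve-∀)
open import Data.Parity.Base using (0ℙ; 1ℙ)
open import Data.Product using (_×_; _,_; proj₁; proj₂; ∃; ∃₂)
open import Data.Sum using (_⊎_; inj₁; inj₂; [_,_]′)
open import Function using (id; _∘_; case_of_)
open import Level using (0ℓ)
open import Relation.Binary using (Rel; Decidable; Symmetric; tri<; tri≈; tri>)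
open import Relation.Binary.Construct.Closure.Symmetric using (SymClosure; fwd; bwd)
  renaming (symmetric to SymClosure-symmetric; fold to SymClosure-fold)
open import Relation.Binary.PropositionalEquality
open import Relation.Nullary using (Dec; does; yes; no; ¬_)
open import Relation.Nullary.Decidable using (_×-dec_; _⊎-dec_; ¬?; dec-true; dec-false; map′)

open import Defs
  using (SimpleGraph; adj; Adj; deg; Graphic; IsRealization; InGS; _at_; HasCycleIn; HasCyclesOnFirst)

-- Counting

private variable P Q : ℕ → Set

does-cong : {A B : Set} (A? : Dec A) (B? : Dec B) → (A → B) → (B → A) → does A? ≡ does B?
does-cong (yes a) B? f g = sym (dec-true B? (f a))
does-cong (no ¬a) B? f g = sym (dec-false B? (λ b → ¬a (g b)))

bit : Bool → ℕ
bit b = if b then 1 else 0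

𝟙 : {A : Set} → Dec A → ℕ
𝟙 A? = bit (does A?)

𝟙-holds : {A : Set} (A? : Dec A) → A → 𝟙 A? ≡ 1
𝟙-holds A? a = cong bit (dec-true A? a)

𝟙-fails : {A : Set} (A? : Dec A) → ¬ A → 𝟙 A? ≡ 0
𝟙-fails A? ¬a = cong bit (dec-false A? ¬a)

𝟙-cong : {A B : Set} (A? : Dec A) (B? : Dec B) → (A → B) → (B → A) → 𝟙 A? ≡ 𝟙 B?
𝟙-cong A? B? f g = cong bit (does-cong A? B? f g)

𝟙-⊎ : {A B : Set} (A? : Dec A) (B? : Dec B) → (A → ¬ B) → 𝟙 (A? ⊎-dec B?) ≡ 𝟙 A? + 𝟙 B?
𝟙-⊎ (yes a) (yes b) disjoint = ⊥-elim (disjoint a b)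
𝟙-⊎ (yes _) (no _) _ = refl
𝟙-⊎ (no _) (yes _) _ = refl
𝟙-⊎ (no _) (no _) _ = refl

𝟙-∖ : {A B : Set} (A? : Dec A) (B? : Dec B) → (B → A) → 𝟙 (A? ×-dec ¬? B?) + 𝟙 B? ≡ 𝟙 A?
𝟙-∖ (yes _) (yes _) _ = refl
𝟙-∖ (yes _) (no _) _ = refl
𝟙-∖ (no ¬a) (yes b) B⊆A = ⊥-elim (¬a (B⊆A b))
𝟙-∖ (no _) (no _) _ = refl

card : ℕ → (∀ v → Dec (P v)) → ℕ
card n P? = sum {n} (λ i → 𝟙 (P? (toℕ i)))

card-∅ : ∀ n (P? : ∀ v → Dec (P v)) → (∀ v → ¬ P v) → card n P? ≡ 0
card-∅ zero P? none = refl
card-∅ (suc n) P? none =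
  cong₂ _+_ (𝟙-fails (P? 0) (none 0)) (card-∅ n (λ v → P? (suc v)) (λ v → none (suc v)))

card-prefix : ∀ n s hi (P? : ∀ v → Dec (P v)) →
  (∀ v → P v → v + s < hi) → (∀ v → v + s < hi → P v) → s ≤ hi → hi ≤ n + s → card n P? + s ≡ hi
card-prefix zero s hi P? sound complete s≤hi hi≤s = ≤-antisym s≤hi hi≤s
card-prefix (suc n) s hi P? sound complete s≤hi hi≤ with m≤n⇒m<n∨m≡n s≤hi
... | inj₂ refl = cong (_+ s) (card-∅ (suc n) P? λ v p → m+n≮n v s (sound v p))
... | inj₁ s<hi = begin
  𝟙 (P? 0) + card n (P? ∘ suc) + s ≡⟨ cong (λ x → x + card n (P? ∘ suc) + s) (𝟙-holds (P? 0) (complete 0 s<hi)) ⟩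
  suc (card n (P? ∘ suc) + s)      ≡⟨ +-suc _ s ⟨
  card n (P? ∘ suc) + suc s        ≡⟨ card-prefix n (suc s) hi (P? ∘ suc)
                                        (λ v p → subst (_< hi) (sym (+-suc v s)) (sound (suc v) p))
                                        (λ v lt → complete (suc v) (subst (_< hi) (+-suc v s) lt))
                                        s<hi (subst (hi ≤_) (sym (+-suc n s)) hi≤) ⟩
  hi                               ∎
  where open ≡-Reasoning

card-⊎ : ∀ n (P? : ∀ v → Dec (P v)) (Q? : ∀ v → Dec (Q v)) → (∀ v → P v → ¬ Q v) →
  card n (λ v → P? v ⊎-dec Q? v) ≡ card n P? + card n Q?
card-⊎ n P? Q? disjoint = trans (sum-cong-≗ {n} (λ i → 𝟙-⊎ (P? (toℕ i)) (Q? (toℕ i)) (disjoint (toℕ i))))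
                                (∑-distrib-+ {n} _ _)

card-∖ : ∀ n (P? : ∀ v → Dec (P v)) (Q? : ∀ v → Dec (Q v)) → (∀ v → Q v → P v) →
  card n (λ v → P? v ×-dec ¬? (Q? v)) + card n Q? ≡ card n P?
card-∖ n P? Q? Q⊆P = trans (sym (∑-distrib-+ {n} _ _))
                           (sum-cong-≗ {n} (λ i → 𝟙-∖ (P? (toℕ i)) (Q? (toℕ i)) (Q⊆P (toℕ i))))

card-interval : ∀ n lo s hi (P? : ∀ v → Dec (P v)) →
  (∀ v → P v → lo ≤ v × v + s < hi) → (∀ v → lo ≤ v → v + s < hi → P v) →
  lo + s ≤ hi → hi ≤ n + s → card n P? + lo + s ≡ hi
card-interval {P = P} n lo s hi P? sound complete lo+s≤hi hi≤ = begin
  card n P? + lo + s                       ≡⟨ cong (λ x → card n P? + x + s) (sym below-lo) ⟩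
  card n P? + card n (_<? lo) + s          ≡⟨ cong (_+ s) (card-⊎ n P? (_<? lo) λ v p v<lo → <⇒≱ v<lo (proj₁ (sound v p))) ⟨
  card n (λ v → P? v ⊎-dec v <? lo) + s    ≡⟨ card-prefix n s hi (λ v → P? v ⊎-dec v <? lo) sound′ complete′ (≤-trans (m≤n+m s lo) lo+s≤hi) hi≤ ⟩
  hi                                       ∎
  where
  open ≡-Reasoning
  below-lo : card n (_<? lo) ≡ lo
  below-lo = trans (sym (+-identityʳ _))
    (card-prefix n 0 lo (_<? lo) (λ v lt → subst (_< lo) (sym (+-identityʳ v)) lt)
                  (λ v lt → subst (_< lo) (+-identityʳ v) lt) z≤n
                  (+-cancelʳ-≤ s lo (n + 0) (≤-trans lo+s≤hi (≤-trans hi≤ (≤-reflexive (cong (_+ s) (sym (+-identityʳ n))))))))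
  sound′ : ∀ v → P v ⊎ v < lo → v + s < hi
  sound′ v (inj₁ p) = proj₂ (sound v p)
  sound′ v (inj₂ v<lo) = <-≤-trans (+-monoˡ-< s v<lo) lo+s≤hi
  complete′ : ∀ v → v + s < hi → P v ⊎ v < lo
  complete′ v lt with lo ≤? v
  ... | yes lo≤v = inj₁ (complete v lo≤v lt)
  ... | no lo≰v = inj₂ (≰⇒> lo≰v)

card-range : ∀ n lo hi (P? : ∀ v → Dec (P v)) →
  (∀ v → P v → lo ≤ v × v < hi) → (∀ v → lo ≤ v → v < hi → P v) → lo ≤ hi → hi ≤ n → card n P? + lo ≡ hi
card-range n lo hi P? sound complete lo≤hi hi≤n = trans (sym (+-identityʳ _)) (card-interval n lo 0 hi P?
  (λ v p → proj₁ (sound v p) , subst (_< hi) (sym (+-identityʳ v)) (proj₂ (sound v p)))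
  (λ v lo≤v lt → complete v lo≤v (subst (_< hi) (+-identityʳ v) lt))
  (subst (_≤ hi) (sym (+-identityʳ lo)) lo≤hi) (subst (hi ≤_) (sym (+-identityʳ n)) hi≤n))

card-singleton : ∀ n w (P? : ∀ v → Dec (P v)) → w < n → (∀ v → P v → v ≡ w) → P w → card n P? ≡ 1
card-singleton {P = P} n w P? w<n only-w Pw = +-cancelʳ-≡ w _ 1 (card-range n w (suc w) P?
  (λ v p → subst (λ x → w ≤ x × x < suc w) (sym (only-w v p)) (≤-refl , ≤-refl))
  (λ v w≤v v<1+w → subst P (≤-antisym w≤v (≤-pred v<1+w)) Pw)
  (n≤1+n w) w<n)

card-interval-∖ : ∀ n lo s hi w (P? : ∀ v → Dec (P v)) → lo ≤ w → w + s < hi →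
  (∀ v → P v → lo ≤ v × v + s < hi × v ≢ w) → (∀ v → lo ≤ v → v + s < hi → v ≢ w → P v) →
  lo + s ≤ hi → hi ≤ n + s → card n P? + 1 + lo + s ≡ hi
card-interval-∖ {P = P} n lo s hi w P? lo≤w w+s<hi sound complete lo+s≤hi hi≤ = begin
  card n P? + 1 + lo + s                 ≡⟨ cong (λ x → card n P? + x + lo + s) (sym only-w) ⟩
  card n P? + card n (_≟ w) + lo + s     ≡⟨ cong (λ x → x + lo + s) (card-⊎ n P? (_≟ w) λ v p → proj₂ (proj₂ (sound v p))) ⟨
  card n (λ v → P? v ⊎-dec v ≟ w) + lo + s ≡⟨ card-interval n lo s hi (λ v → P? v ⊎-dec v ≟ w) sound′ complete′ lo+s≤hi hi≤ ⟩
  hi                                     ∎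
  where
  open ≡-Reasoning
  only-w : card n (_≟ w) ≡ 1
  only-w = card-singleton n w (_≟ w) (+-cancelʳ-< s w n (<-≤-trans w+s<hi hi≤)) (λ _ e → e) refl
  sound′ : ∀ v → P v ⊎ v ≡ w → lo ≤ v × v + s < hi
  sound′ v (inj₁ p) = proj₁ (sound v p) , proj₁ (proj₂ (sound v p))
  sound′ v (inj₂ refl) = lo≤w , w+s<hi
  complete′ : ∀ v → lo ≤ v → v + s < hi → P v ⊎ v ≡ w
  complete′ v lo≤v lt with v ≟ w
  ... | yes v≡w = inj₂ v≡w
  ... | no v≢w = inj₁ (complete v lo≤v lt v≢w)

-- Even degree sums

listSum-allFin : ∀ {n} (f : Fin n → ℕ) → listSum (map f (allFin n)) ≡ sum f
listSum-allFin {n} f = trans (cong listSum (map-tabulate id f)) (go f)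
  where
  go : ∀ {n} (f : Fin n → ℕ) → listSum (tabulate f) ≡ sum f
  go {zero} f = refl
  go {suc n} f = cong (f zero +_) (go (f ∘ suc))

-- Each unordered pair {i, j} is counted once by the upper triangle and once by its transpose.
∑∑-symmetric-even : ∀ {n} (f : Fin n → Fin n → ℕ) → (∀ i j → f i j ≡ f j i) → (∀ i → f i i ≡ 0) →
  2 ∣ sum (λ i → sum (f i))
∑∑-symmetric-even {n} f f-sym f-diag = subst (2 ∣_) (sym total) (m∣m*n (∑∑ upper))
  where
  ∑∑ : (Fin n → Fin n → ℕ) → ℕ
  ∑∑ g = sum (λ i → sum (g i))

  upper : Fin n → Fin n → ℕ
  upper i j = 𝟙 (i Fin.<? j) * f i j

  split : ∀ i j → f i j ≡ upper i j + upper j i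
  split i j with Fin.<-cmp i j
  ... | tri< i<j _ j≮i rewrite 𝟙-holds (i Fin.<? j) i<j | 𝟙-fails (j Fin.<? i) j≮i =
    sym (trans (+-identityʳ _) (+-identityʳ _))
  ... | tri> i≮j _ j<i rewrite 𝟙-fails (i Fin.<? j) i≮j | 𝟙-holds (j Fin.<? i) j<i =
    trans (f-sym i j) (sym (+-identityʳ _))
  ... | tri≈ i≮j refl _ rewrite 𝟙-fails (i Fin.<? i) i≮j = f-diag i

  total : ∑∑ f ≡ 2 * ∑∑ upper
  total = begin
    ∑∑ f                                         ≡⟨ sum-cong-≗ (λ i → sum-cong-≗ (split i)) ⟩
    ∑∑ (λ i j → upper i j + upper j i)           ≡⟨ sum-cong-≗ (λ i → ∑-distrib-+ (upper i) (λ j → upper j i)) ⟩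
    sum (λ i → sum (upper i) + sum (λ j → upper j i)) ≡⟨ ∑-distrib-+ (λ i → sum (upper i)) _ ⟩
    ∑∑ upper + ∑∑ (λ i j → upper j i)            ≡⟨ cong (∑∑ upper +_) (sym (∑-comm upper)) ⟩
    ∑∑ upper + ∑∑ upper                          ≡⟨ cong (∑∑ upper +_) (sym (+-identityʳ _)) ⟩
    2 * ∑∑ upper                                 ∎
    where open ≡-Reasoning

deg-sum-even : ∀ {n} (G : SimpleGraph n) → 2 ∣ sum (deg G)
deg-sum-even {n} G = subst (2 ∣_) (sum-cong-≗ {n} (λ i → sym (listSum-allFin (edge i))))
  (∑∑-symmetric-even edge (λ i j → cong bit (SimpleGraph.sym G i j)) (λ i → cong bit (SimpleGraph.irrefl G i)))
  where
  edge : Fin n → Fin n → ℕ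
  edge i j = bit (adj G i j)

graphic-sum-even : ∀ {n} {d : Fin n → ℕ} → Graphic d → 2 ∣ sum d
graphic-sum-even {n} (G , realizes) = subst (2 ∣_) (sum-cong-≗ {n} realizes) (deg-sum-even G)

same-parity-in-[1,2] : ∀ {s x y} → 2 ∣ s + x → 2 ∣ s + y → 1 ≤ x → x ≤ 2 → 1 ≤ y → y ≤ 2 → x ≡ y
same-parity-in-[1,2] {s} {1} {1} _ _ _ _ _ _ = refl
same-parity-in-[1,2] {s} {2} {2} _ _ _ _ _ _ = refl
same-parity-in-[1,2] {s} {1} {2} 2∣s+1 2∣s+2 _ _ _ _ =
  case ∣1⇒≡1 (∣m+n∣m⇒∣n (subst (2 ∣_) (sym (+-assoc s 1 1)) 2∣s+2) 2∣s+1) of λ ()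
same-parity-in-[1,2] {s} {2} {1} 2∣s+2 2∣s+1 _ _ _ _ =
  case ∣1⇒≡1 (∣m+n∣m⇒∣n (subst (2 ∣_) (sym (+-assoc s 1 1)) 2∣s+2) 2∣s+1) of λ ()
same-parity-in-[1,2] {x = suc (suc (suc _))} _ _ _ (s≤s (s≤s ())) _ _
same-parity-in-[1,2] {y = suc (suc (suc _))} _ _ _ _ _ (s≤s (s≤s ()))

last-entry-by-parity : ∀ {n} (f g : Fin (suc n) → ℕ) → (∀ i → f (inject₁ i) ≡ g (inject₁ i)) →
  2 ∣ sum f → 2 ∣ sum g → 1 ≤ f (fromℕ n) → f (fromℕ n) ≤ 2 → 1 ≤ g (fromℕ n) → g (fromℕ n) ≤ 2 →
  f (fromℕ n) ≡ g (fromℕ n)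
last-entry-by-parity {n} f g init-agree 2∣f 2∣g =
  same-parity-in-[1,2] (subst (2 ∣_) (sum-init-last f) 2∣f)
                       (subst (2 ∣_) (trans (sum-init-last g) (cong (_+ g (fromℕ n)) (sym (sum-cong-≗ {n} init-agree)))) 2∣g)

at-suc : ∀ {n} (d : Fin n → ℕ) j (j<n : j < n) → d at suc j ≡ d (fromℕ< j<n)
at-suc {n} d j j<n with j <? n
... | yes j<n′ = cong d (toℕ-injective (trans (toℕ-fromℕ< j<n′) (sym (toℕ-fromℕ< j<n))))
... | no j≮n = ⊥-elim (j≮n j<n)

at-suc-toℕ : ∀ {n} (d : Fin n → ℕ) (i : Fin n) → d at suc (toℕ i) ≡ d i
at-suc-toℕ d i = trans (at-suc d (toℕ i) (toℕ<n i)) (cong d (toℕ-injective (toℕ-fromℕ< (toℕ<n i))))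

toℕ≮n⇒fromℕ : ∀ {n} (x : Fin (suc n)) → ¬ toℕ x < n → x ≡ fromℕ n
toℕ≮n⇒fromℕ {n} x x≮n = toℕ-injective (trans (≤-antisym (≤-pred (toℕ<n x)) (≮⇒≥ x≮n)) (sym (toℕ-fromℕ n)))

even-or-odd : ∀ j → ∃ λ i → j ≡ i + i ⊎ j ≡ suc (i + i)
even-or-odd zero = 0 , inj₁ refl
even-or-odd (suc j) with even-or-odd j
... | i , inj₁ refl = i , inj₂ refl
... | i , inj₂ refl = suc i , inj₁ (cong suc (sym (+-suc i i)))

halve : ∀ n → ∃₂ λ h e → n ≡ h + h + e × e ≤ 1
halve n with even-or-odd n
... | h , inj₁ refl = h , 0 , sym (+-identityʳ _) , z≤n
... | h , inj₂ refl = h , 1 , +-comm 1 (h + h) , ≤-refl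

-- The graph

symClosure? : ∀ {A : Set} {R : Rel A 0ℓ} → Decidable R → Decidable (SymClosure R)
symClosure? R? u v = map′ [ fwd , bwd ]′ (λ { (fwd r) → inj₁ r ; (bwd r) → inj₂ r }) (R? u v ⊎-dec R? v u)

module Construction (m h p a q b : ℕ) (5≤m : 5 ≤ m) (h+h≤m : h + h ≤ m) (m≤1+h+h : m ≤ suc (h + h))
  (p≤h : p ≤ h) (p+a+2≤m : p + a + 2 ≤ m) (p+a≡q+q+b : p + a ≡ q + q + b) (b≤1 : b ≤ 1) where

  k : ℕ
  k = p + a

  N : ℕ
  N = suc (m + m)

  Threshold : Rel ℕ 0ℓ
  Threshold u v = u + v ≤ m + m × u ≢ v

  LowCut : Rel ℕ 0ℓ
  LowCut u v = 1 ≤ u × 1 ≤ v × u + v ≤ m × u ≢ v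

  ApexArc : Rel ℕ 0ℓ
  ApexArc u v = u ≡ 0 × p < v × v ≤ h

  UpperArc : Rel ℕ 0ℓ
  UpperArc u v = (1 ≤ u × u ≤ p × u + v ≡ suc (m + p)) ⊎ (u ≡ 0 × m + p < v × v ≤ m + k)

  -- u ↦ u + q + b pairs (m, m + q] with (m + q + b, m + k]; when b = 1 the leftover m + q + 1 is paired with m + m.
  MatchArc : Rel ℕ 0ℓ
  MatchArc u v = (m < u × u ≤ m + q × v ≡ u + q + b) ⊎ (b ≡ 1 × u ≡ suc (m + q) × v ≡ m + m)

  ApexCut UpperCut Matching : Rel ℕ 0ℓ
  ApexCut = SymClosure ApexArc
  UpperCut = SymClosure UpperArc
  Matching = SymClosure MatchArc

  Cut : Rel ℕ 0ℓ
  Cut u v = LowCut u v ⊎ ApexCut u v ⊎ UpperCut u v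

  Edge : Rel ℕ 0ℓ
  Edge u v = (Threshold u v × ¬ Cut u v) ⊎ Matching u v

  _≢?_ : Decidable _≢_
  u ≢? v = ¬? (u ≟ v)

  Threshold? : Decidable Threshold
  Threshold? u v = (u + v ≤? m + m) ×-dec (u ≢? v)

  LowCut? : Decidable LowCut
  LowCut? u v = (1 ≤? u) ×-dec (1 ≤? v) ×-dec (u + v ≤? m) ×-dec (u ≢? v)

  ApexArc? : Decidable ApexArc
  ApexArc? u v = (u ≟ 0) ×-dec (p <? v) ×-dec (v ≤? h)

  UpperArc? : Decidable UpperArc
  UpperArc? u v = ((1 ≤? u) ×-dec (u ≤? p) ×-dec (u + v ≟ suc (m + p)))
           ⊎-dec ((u ≟ 0) ×-dec (m + p <? v) ×-dec (v ≤? m + k))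

  MatchArc? : Decidable MatchArc
  MatchArc? u v = ((m <? u) ×-dec (u ≤? m + q) ×-dec (v ≟ u + q + b))
           ⊎-dec ((b ≟ 1) ×-dec (u ≟ suc (m + q)) ×-dec (v ≟ m + m))

  ApexCut? : Decidable ApexCut
  ApexCut? = symClosure? ApexArc?

  UpperCut? : Decidable UpperCut
  UpperCut? = symClosure? UpperArc?

  Matching? : Decidable Matching
  Matching? = symClosure? MatchArc?

  Cut? : Decidable Cut
  Cut? u v = LowCut? u v ⊎-dec ApexCut? u v ⊎-dec UpperCut? u v

  Edge? : Decidable Edge
  Edge? u v = (Threshold? u v ×-dec ¬? (Cut? u v)) ⊎-dec Matching? u v

  Threshold-sym : Symmetric Threshold
  Threshold-sym {u} {v} (u+v≤ , u≢v) = subst (_≤ m + m) (+-comm u v) u+v≤ , ≢-sym u≢v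

  LowCut-sym : Symmetric LowCut
  LowCut-sym {u} {v} (1≤u , 1≤v , u+v≤ , u≢v) = 1≤v , 1≤u , subst (_≤ m) (+-comm u v) u+v≤ , ≢-sym u≢v

  Cut-sym : Symmetric Cut
  Cut-sym (inj₁ c) = inj₁ (LowCut-sym c)
  Cut-sym (inj₂ (inj₁ c)) = inj₂ (inj₁ (SymClosure-symmetric ApexArc c))
  Cut-sym (inj₂ (inj₂ c)) = inj₂ (inj₂ (SymClosure-symmetric UpperArc c))

  Edge-sym : Symmetric Edge
  Edge-sym (inj₁ (t , ¬c)) = inj₁ (Threshold-sym t , λ c → ¬c (Cut-sym c))
  Edge-sym (inj₂ e) = inj₂ (SymClosure-symmetric MatchArc e)

  m≤m+m : m ≤ m + m
  m≤m+m = m≤m+n m m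

  h≤m : h ≤ m
  h≤m = ≤-trans (m≤m+n h h) h+h≤m

  k+2≤m : k + 2 ≤ m
  k+2≤m = p+a+2≤m

  k<m : k < m
  k<m = ≤-trans (≤-reflexive (+-comm 1 k)) (≤-trans (+-monoʳ-≤ k (s≤s z≤n)) k+2≤m)

  p≤k : p ≤ k
  p≤k = m≤m+n p a

  p<m : p < m
  p<m = ≤-<-trans p≤k k<m

  q≤k : q ≤ k
  q≤k = ≤-trans (≤-trans (m≤m+n q q) (m≤m+n (q + q) b)) (≤-reflexive (sym p+a≡q+q+b))

  q+2≤m : q + 2 ≤ m
  q+2≤m = ≤-trans (+-monoˡ-≤ 2 q≤k) k+2≤m

  h+3≤m : h + 3 ≤ m
  h+3≤m = go h h+h≤m
    where
    go : ∀ x → x + x ≤ m → x + 3 ≤ m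
    go 0 _ = ≤-trans (s≤s (s≤s (s≤s z≤n))) 5≤m
    go 1 _ = ≤-trans (s≤s (s≤s (s≤s (s≤s z≤n)))) 5≤m
    go 2 _ = 5≤m
    go (suc (suc (suc x))) le = ≤-trans (+-monoʳ-≤ (3 + x) (s≤s (s≤s (s≤s z≤n)))) le

  h<m : h < m
  h<m = ≤-trans (≤-reflexive (+-comm 1 h)) (≤-trans (+-monoʳ-≤ h (s≤s z≤n)) h+3≤m)

  LowCut⊆Threshold : ∀ {u v} → LowCut u v → Threshold u v
  LowCut⊆Threshold (_ , _ , u+v≤m , u≢v) = ≤-trans u+v≤m m≤m+m , u≢v

  ApexArc⊆Threshold : ∀ {u v} → ApexArc u v → Threshold u v
  ApexArc⊆Threshold (refl , p<v , v≤h) = ≤-trans v≤h (≤-trans h≤m m≤m+m) , λ { refl → n≮0 p<v }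

  m+p<m+m : m + p < m + m
  m+p<m+m = +-monoʳ-< m p<m

  UpperArc⊆Threshold : ∀ {u v} → UpperArc u v → Threshold u v
  UpperArc⊆Threshold {u} (inj₁ (_ , u≤p , u+v≡)) = ≤-trans (≤-reflexive u+v≡) m+p<m+m , u≢v
    where
    u≢v : u ≢ _
    u≢v refl = <-irrefl u+v≡ (s≤s (+-mono-≤ (≤-trans u≤p (<⇒≤ p<m)) u≤p))
  UpperArc⊆Threshold (inj₂ (refl , m+p<v , v≤m+k)) = ≤-trans v≤m+k (+-monoʳ-≤ m (<⇒≤ k<m)) , λ { refl → n≮0 m+p<v }

  Cut⊆Threshold : ∀ {u v} → Cut u v → Threshold u v
  Cut⊆Threshold (inj₁ c) = LowCut⊆Threshold c
  Cut⊆Threshold (inj₂ (inj₁ c)) = SymClosure-fold Threshold-sym ApexArc⊆Threshold c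
  Cut⊆Threshold (inj₂ (inj₂ c)) = SymClosure-fold Threshold-sym UpperArc⊆Threshold c

  MatchArc⇒¬Threshold : ∀ {u v} → MatchArc u v → ¬ Threshold u v
  MatchArc⇒¬Threshold {u} (inj₁ (m<u , _ , refl)) (le , _) =
    <⇒≱ (<-≤-trans (+-mono-< m<u m<u) (+-monoʳ-≤ u (≤-trans (m≤m+n u q) (m≤m+n (u + q) b)))) le
  MatchArc⇒¬Threshold (inj₂ (_ , refl , refl)) (le , _) = <⇒≱ (s≤s (m≤n+m (m + m) (m + q))) le

  Matching⇒¬Threshold : ∀ {u v} → Matching u v → ¬ Threshold u v
  Matching⇒¬Threshold (fwd arc) t = MatchArc⇒¬Threshold arc t
  Matching⇒¬Threshold (bwd arc) t = MatchArc⇒¬Threshold arc (Threshold-sym t)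

  1+m+q<m+m : suc (m + q) < m + m
  1+m+q<m+m = ≤-trans (≤-reflexive (shift m q)) (+-monoʳ-≤ m q+2≤m)
    where
    shift : ∀ m q → suc (suc (m + q)) ≡ m + (q + 2)
    shift = solve-∀

  MatchArc-irrefl : ∀ {u} → ¬ MatchArc u u
  MatchArc-irrefl {u} (inj₁ (m<u , u≤m+q , u≡u+q+b)) =
    <⇒≱ m<u (≤-trans (subst (λ x → u ≤ m + x) q≡0 u≤m+q) (≤-reflexive (+-identityʳ m)))
    where
    q≡0 : q ≡ 0
    q≡0 = m+n≡0⇒m≡0 q (+-cancelˡ-≡ u (q + b) 0 (trans (sym (trans u≡u+q+b (+-assoc u q b))) (sym (+-identityʳ u))))
  MatchArc-irrefl (inj₂ (_ , refl , e)) = <-irrefl e 1+m+q<m+m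

  Edge-irrefl : ∀ {u} → ¬ Edge u u
  Edge-irrefl (inj₁ ((_ , u≢u) , _)) = u≢u refl
  Edge-irrefl (inj₂ (fwd arc)) = MatchArc-irrefl arc
  Edge-irrefl (inj₂ (bwd arc)) = MatchArc-irrefl arc

  1+m+p≰m : suc (m + p) ≰ m
  1+m+p≰m le = n≮n m (≤-trans (s≤s (m≤m+n m p)) le)

  LowCut⇒¬ApexCut : ∀ {u v} → LowCut u v → ¬ ApexCut u v
  LowCut⇒¬ApexCut (1≤u , _ , _) (fwd (refl , _)) = <⇒≱ 1≤u z≤n
  LowCut⇒¬ApexCut (_ , 1≤v , _) (bwd (refl , _)) = <⇒≱ 1≤v z≤n

  LowCut⇒¬UpperCut : ∀ {u v} → LowCut u v → ¬ UpperCut u v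
  LowCut⇒¬UpperCut (_ , _ , u+v≤m , _) (fwd (inj₁ (_ , _ , u+v≡))) = 1+m+p≰m (subst (_≤ m) u+v≡ u+v≤m)
  LowCut⇒¬UpperCut {u} {v} (_ , _ , u+v≤m , _) (bwd (inj₁ (_ , _ , v+u≡))) = 1+m+p≰m (subst (_≤ m) (trans (+-comm u v) v+u≡) u+v≤m)
  LowCut⇒¬UpperCut (1≤u , _ , _) (fwd (inj₂ (refl , _))) = <⇒≱ 1≤u z≤n
  LowCut⇒¬UpperCut (_ , 1≤v , _) (bwd (inj₂ (refl , _))) = <⇒≱ 1≤v z≤n

  ApexArc⇒¬UpperCut : ∀ {u v} → ApexArc u v → ¬ UpperCut u v
  ApexArc⇒¬UpperCut (refl , _ , _) (fwd (inj₁ (1≤0 , _))) = <⇒≱ 1≤0 z≤n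
  ApexArc⇒¬UpperCut (refl , _ , v≤h) (fwd (inj₂ (_ , m+p<v , _))) = <⇒≱ m+p<v (≤-trans (≤-trans v≤h h≤m) (m≤m+n m p))
  ApexArc⇒¬UpperCut {v = v} (refl , _ , v≤h) (bwd (inj₁ (_ , _ , v+0≡))) =
    1+m+p≰m (subst (_≤ m) (trans (sym (+-identityʳ v)) v+0≡) (≤-trans v≤h h≤m))
  ApexArc⇒¬UpperCut (refl , p<v , _) (bwd (inj₂ (refl , _))) = n≮0 p<v

  LowCut⇒¬ApexCut⊎UpperCut : ∀ {u v} → LowCut u v → ¬ (ApexCut u v ⊎ UpperCut u v)
  LowCut⇒¬ApexCut⊎UpperCut low = [ LowCut⇒¬ApexCut low , LowCut⇒¬UpperCut low ]′

  ApexCut⇒¬UpperCut : ∀ {u v} → ApexCut u v → ¬ UpperCut u v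
  ApexCut⇒¬UpperCut (fwd arc) up = ApexArc⇒¬UpperCut arc up
  ApexCut⇒¬UpperCut (bwd arc) up = ApexArc⇒¬UpperCut arc (SymClosure-symmetric UpperArc up)

  -- Degrees

  degreeIn : {R : Rel ℕ 0ℓ} → Decidable R → ℕ → ℕ
  degreeIn R? u = card N (R? u)

  degree : ℕ → ℕ
  degree = degreeIn Edge?

  degree-balance : ∀ u → degree u + (degreeIn LowCut? u + (degreeIn ApexCut? u + degreeIn UpperCut? u))
                       ≡ degreeIn Threshold? u + degreeIn Matching? u
  degree-balance u = begin
    degree u + (#L + (#A + #U))    ≡⟨ cong (λ x → degree u + (#L + x)) (card-⊎ N (ApexCut? u) (UpperCut? u) λ _ → ApexCut⇒¬UpperCut) ⟨
    degree u + (#L + #AU)          ≡⟨ cong (degree u +_) (card-⊎ N (LowCut? u) AU? λ _ → LowCut⇒¬ApexCut⊎UpperCut) ⟨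
    degree u + #C                  ≡⟨ cong (_+ #C) (card-⊎ N Kept? (Matching? u) λ _ kept match → Matching⇒¬Threshold match (proj₁ kept)) ⟩
    #Kept + #M + #C                ≡⟨ xy∙z≈xz∙y #Kept #M #C ⟩
    #Kept + #C + #M                ≡⟨ cong (_+ #M) (card-∖ N (Threshold? u) (Cut? u) λ _ → Cut⊆Threshold) ⟩
    degreeIn Threshold? u + #M     ∎
    where
    open ≡-Reasoning
    AU? = λ v → ApexCut? u v ⊎-dec UpperCut? u v
    Kept? = λ v → Threshold? u v ×-dec ¬? (Cut? u v)
    #L = degreeIn LowCut? u
    #A = degreeIn ApexCut? u
    #U = degreeIn UpperCut? u
    #AU = card N AU?
    #C = degreeIn Cut? u
    #M = degreeIn Matching? u
    #Kept = card N Kept?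

  private
    x+1+0+y : ∀ x y → x + 1 + 0 + y ≡ suc (x + y)
    x+1+0+y = solve-∀

    x+1+1+y : ∀ x y → x + 1 + 1 + y ≡ suc (x + 1 + y)
    x+1+1+y = solve-∀

    x+1+y : ∀ x y → x + 1 + y ≡ suc (x + y)
    x+1+y = solve-∀

  threshold-degree-≤m : ∀ u → u ≤ m → degreeIn Threshold? u + u ≡ m + m
  threshold-degree-≤m u u≤m = suc-injective (trans (sym (x+1+0+y _ u))
    (card-interval-∖ N 0 u N u (Threshold? u) z≤n (s≤s (+-mono-≤ u≤m u≤m))
      (λ v (u+v≤ , u≢v) → z≤n , s≤s (subst (_≤ m + m) (+-comm u v) u+v≤) , ≢-sym u≢v)
      (λ v _ lt v≢u → subst (_≤ m + m) (+-comm v u) (≤-pred lt) , ≢-sym v≢u)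
      (≤-trans u≤m (≤-trans m≤m+m (n≤1+n _))) (m≤m+n N u)))

  threshold-degree->m : ∀ u → m < u → u ≤ m + m → degreeIn Threshold? u + u ≡ N
  threshold-degree->m u m<u u≤m+m = card-prefix N u N (Threshold? u)
    (λ v (u+v≤ , _) → s≤s (subst (_≤ m + m) (+-comm u v) u+v≤))
    (λ v lt → subst (_≤ m + m) (+-comm v u) (≤-pred lt) , λ { refl → <⇒≱ (+-mono-< m<u m<u) (≤-pred lt) })
    (≤-trans u≤m+m (n≤1+n _)) (m≤m+n N u)

  lowCut-degree-0 : degreeIn LowCut? 0 ≡ 0
  lowCut-degree-0 = card-∅ N (LowCut? 0) λ v (1≤0 , _) → <⇒≱ 1≤0 z≤n

  lowCut-degree->m : ∀ u → m < u → degreeIn LowCut? u ≡ 0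
  lowCut-degree->m u m<u = card-∅ N (LowCut? u) λ v (_ , _ , u+v≤m , _) → <⇒≱ m<u (≤-trans (m≤m+n u v) u+v≤m)

  lowCut-degree-≤h : ∀ u → 1 ≤ u → u + u ≤ m → degreeIn LowCut? u + 1 + u ≡ m
  lowCut-degree-≤h u 1≤u u+u≤m = suc-injective (trans (sym (x+1+1+y _ u))
    (card-interval-∖ N 1 u (suc m) u (LowCut? u) 1≤u (s≤s u+u≤m)
      (λ v (_ , 1≤v , u+v≤m , u≢v) → 1≤v , s≤s (subst (_≤ m) (+-comm u v) u+v≤m) , ≢-sym u≢v)
      (λ v 1≤v lt v≢u → 1≤u , 1≤v , subst (_≤ m) (+-comm v u) (≤-pred lt) , ≢-sym v≢u)
      (s≤s (≤-trans (m≤n+m u u) u+u≤m)) (≤-trans (s≤s (m≤m+n m m)) (m≤m+n N u))))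

  lowCut-degree->h : ∀ u → 1 ≤ u → u ≤ m → m < u + u → degreeIn LowCut? u + u ≡ m
  lowCut-degree->h u 1≤u u≤m m<u+u = suc-injective (trans (sym (x+1+y _ u))
    (card-interval N 1 u (suc m) (LowCut? u)
      (λ v (_ , 1≤v , u+v≤m , _) → 1≤v , s≤s (subst (_≤ m) (+-comm u v) u+v≤m))
      (λ v 1≤v lt → 1≤u , 1≤v , subst (_≤ m) (+-comm v u) (≤-pred lt) , λ { refl → <⇒≱ m<u+u (≤-pred lt) })
      (s≤s u≤m) (≤-trans (s≤s (m≤m+n m m)) (m≤m+n N u))))

  apexCut-degree-0 : degreeIn ApexCut? 0 + suc p ≡ suc h
  apexCut-degree-0 = card-range N (suc p) (suc h) (ApexCut? 0) sound complete (s≤s p≤h) (s≤s (≤-trans h≤m m≤m+m))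
    where
    sound : ∀ v → ApexCut 0 v → p < v × v < suc h
    sound v (fwd (_ , p<v , v≤h)) = p<v , s≤s v≤h
    sound v (bwd (_ , p<0 , _)) = ⊥-elim (n≮0 p<0)
    complete : ∀ v → p < v → v < suc h → ApexCut 0 v
    complete v p<v v<1+h = fwd (refl , p<v , ≤-pred v<1+h)

  apexCut-degree-inner : ∀ u → p < u → u ≤ h → degreeIn ApexCut? u ≡ 1
  apexCut-degree-inner u p<u u≤h = card-singleton N 0 (ApexCut? u) (s≤s z≤n) only-0 (bwd (refl , p<u , u≤h))
    where
    only-0 : ∀ v → ApexCut u v → v ≡ 0
    only-0 v (fwd (refl , _)) = ⊥-elim (n≮0 p<u)
    only-0 v (bwd (v≡0 , _)) = v≡0

  apexCut-degree-outer : ∀ u → u ≢ 0 → ¬ (p < u × u ≤ h) → degreeIn ApexCut? u ≡ 0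
  apexCut-degree-outer u u≢0 outside = card-∅ N (ApexCut? u) none
    where
    none : ∀ v → ¬ ApexCut u v
    none v (fwd (u≡0 , _)) = u≢0 u≡0
    none v (bwd (_ , p<u , u≤h)) = outside (p<u , u≤h)

  m+k<N : m + k < N
  m+k<N = s≤s (+-monoʳ-≤ m (<⇒≤ k<m))

  upperCut-degree-0 : degreeIn UpperCut? 0 + suc (m + p) ≡ suc (m + k)
  upperCut-degree-0 = card-range N (suc (m + p)) (suc (m + k)) (UpperCut? 0) sound complete (s≤s (+-monoʳ-≤ m p≤k)) m+k<N
    where
    sound : ∀ v → UpperCut 0 v → m + p < v × v < suc (m + k)
    sound v (fwd (inj₁ (1≤0 , _))) = ⊥-elim (<⇒≱ 1≤0 z≤n)
    sound v (fwd (inj₂ (_ , m+p<v , v≤m+k))) = m+p<v , s≤s v≤m+k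
    sound v (bwd (inj₁ (_ , v≤p , v+0≡))) =
      ⊥-elim (1+m+p≰m (≤-trans (≤-reflexive (trans (sym v+0≡) (+-identityʳ v))) (≤-trans v≤p (<⇒≤ p<m))))
    sound v (bwd (inj₂ (_ , m+p<0 , _))) = ⊥-elim (n≮0 m+p<0)
    complete : ∀ v → m + p < v → v < suc (m + k) → UpperCut 0 v
    complete v m+p<v v<1+m+k = fwd (inj₂ (refl , m+p<v , ≤-pred v<1+m+k))

  upperCut-degree-≤p : ∀ u → 1 ≤ u → u ≤ p → degreeIn UpperCut? u ≡ 1
  upperCut-degree-≤p u 1≤u u≤p = card-singleton N w (UpperCut? u) w<N only-w (fwd (inj₁ (1≤u , u≤p , m+[n∸m]≡n u≤)))
    where
    w = suc (m + p) ∸ u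
    u≤ : u ≤ suc (m + p)
    u≤ = ≤-trans u≤p (≤-trans (m≤n+m p m) (n≤1+n _))
    w<N : w < N
    w<N = s≤s (≤-trans (m∸n≤m _ u) m+p<m+m)
    only-w : ∀ v → UpperCut u v → v ≡ w
    only-w v (fwd (inj₁ (_ , _ , u+v≡))) = trans (sym (m+n∸m≡n u v)) (cong (_∸ u) u+v≡)
    only-w v (fwd (inj₂ (refl , _))) = ⊥-elim (<⇒≱ 1≤u z≤n)
    only-w v (bwd (inj₁ (_ , v≤p , v+u≡))) =
      ⊥-elim (<-irrefl v+u≡ (s≤s (≤-trans (+-mono-≤ v≤p (≤-trans u≤p (<⇒≤ p<m))) (≤-reflexive (+-comm p m)))))
    only-w v (bwd (inj₂ (_ , m+p<u , _))) = ⊥-elim (<⇒≱ m+p<u (≤-trans u≤p (m≤n+m p m)))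

  token-partner≤m+p : ∀ {u v} → 1 ≤ v → v + u ≡ suc (m + p) → u ≤ m + p
  token-partner≤m+p {u} {v} 1≤v v+u≡ =
    ≤-pred (≤-trans (≤-trans (≤-reflexive (+-comm 1 u)) (+-monoʳ-≤ u 1≤v)) (≤-reflexive (trans (+-comm u v) v+u≡)))

  upperCut-degree-upper : ∀ u → m < u → u ≤ m + k → degreeIn UpperCut? u ≡ 1
  upperCut-degree-upper u m<u u≤m+k with u ≤? m + p
  ... | yes u≤m+p = card-singleton N w (UpperCut? u) w<N only-w (bwd (inj₁ (1≤w , w≤p , m∸n+n≡m u≤)))
    where
    w = suc (m + p) ∸ u
    u≤ : u ≤ suc (m + p)
    u≤ = ≤-trans u≤m+p (n≤1+n _)
    w<N : w < N
    w<N = s≤s (≤-trans (m∸n≤m _ u) m+p<m+m)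
    1≤w : 1 ≤ w
    1≤w = subst (_≤ w) (m+n∸n≡m 1 u) (∸-monoˡ-≤ u (s≤s u≤m+p))
    w≤p : w ≤ p
    w≤p = +-cancelʳ-≤ u w p (≤-trans (≤-reflexive (m∸n+n≡m u≤))
            (≤-trans (≤-reflexive (cong suc (+-comm m p))) (≤-trans (≤-reflexive (sym (+-suc p m))) (+-monoʳ-≤ p m<u))))
    only-w : ∀ v → UpperCut u v → v ≡ w
    only-w v (fwd (inj₁ (_ , u≤p , _))) = ⊥-elim (<⇒≱ m<u (≤-trans u≤p (<⇒≤ p<m)))
    only-w v (fwd (inj₂ (refl , _))) = ⊥-elim (n≮0 m<u)
    only-w v (bwd (inj₁ (_ , _ , v+u≡))) = trans (sym (m+n∸n≡m v u)) (cong (_∸ u) v+u≡)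
    only-w v (bwd (inj₂ (_ , m+p<u , _))) = ⊥-elim (<⇒≱ m+p<u u≤m+p)
  ... | no u≰m+p = card-singleton N 0 (UpperCut? u) (s≤s z≤n) only-0 (bwd (inj₂ (refl , ≰⇒> u≰m+p , u≤m+k)))
    where
    only-0 : ∀ v → UpperCut u v → v ≡ 0
    only-0 v (fwd (inj₁ (_ , u≤p , _))) = ⊥-elim (<⇒≱ m<u (≤-trans u≤p (<⇒≤ p<m)))
    only-0 v (fwd (inj₂ (refl , _))) = ⊥-elim (n≮0 m<u)
    only-0 v (bwd (inj₁ (1≤v , _ , v+u≡))) = ⊥-elim (u≰m+p (token-partner≤m+p 1≤v v+u≡))
    only-0 v (bwd (inj₂ (v≡0 , _))) = v≡0

  upperCut-degree-outer : ∀ u → u ≢ 0 → u ≰ p → ¬ (m < u × u ≤ m + k) → degreeIn UpperCut? u ≡ 0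
  upperCut-degree-outer u u≢0 u≰p outside = card-∅ N (UpperCut? u) none
    where
    none : ∀ v → ¬ UpperCut u v
    none v (fwd (inj₁ (_ , u≤p , _))) = u≰p u≤p
    none v (fwd (inj₂ (u≡0 , _))) = u≢0 u≡0
    none v (bwd (inj₁ (1≤v , v≤p , v+u≡))) = outside (m<u , ≤-trans u≤m+p (+-monoʳ-≤ m p≤k))
      where
      u≤m+p : u ≤ m + p
      u≤m+p = token-partner≤m+p 1≤v v+u≡
      m<u : m < u
      m<u = +-cancelˡ-≤ p (suc m) u (≤-trans (≤-reflexive (trans (+-suc p m) (cong suc (+-comm p m))))
                                      (≤-trans (≤-reflexive (sym v+u≡)) (+-monoˡ-≤ u v≤p)))
    none v (bwd (inj₂ (_ , m+p<u , u≤m+k))) = outside (≤-<-trans (m≤m+n m p) m+p<u , u≤m+k)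

  m+q<m+m : m + q < m + m
  m+q<m+m = ≤-trans (n≤1+n _) 1+m+q<m+m

  m+k<m+m : m + k < m + m
  m+k<m+m = +-monoʳ-< m k<m

  q+q+b≡k : q + (q + b) ≡ k
  q+q+b≡k = trans (sym (+-assoc q q b)) (sym p+a≡q+q+b)

  partner≤m+k : ∀ u → u ≤ m + q → u + q + b ≤ m + k
  partner≤m+k u u≤m+q = ≤-trans (≤-reflexive (+-assoc u q b))
    (≤-trans (+-monoˡ-≤ (q + b) u≤m+q) (≤-reflexive (trans (+-assoc m q (q + b)) (cong (m +_) q+q+b≡k))))

  matching-degree-first-half : ∀ u → m < u → u ≤ m + q → degreeIn Matching? u ≡ 1
  matching-degree-first-half u m<u u≤m+q =
    card-singleton N (u + q + b) (Matching? u) (≤-<-trans (partner≤m+k u u≤m+q) m+k<N) only (fwd (inj₁ (m<u , u≤m+q , refl)))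
    where
    only : ∀ v → Matching u v → v ≡ u + q + b
    only v (fwd (inj₁ (_ , _ , v≡))) = v≡
    only v (fwd (inj₂ (_ , refl , _))) = ⊥-elim (<⇒≱ (n<1+n _) u≤m+q)
    only v (bwd (inj₁ (m<v , _ , refl))) = ⊥-elim (<⇒≱ (≤-trans (+-monoˡ-< q m<v) (m≤m+n (v + q) b)) u≤m+q)
    only v (bwd (inj₂ (_ , _ , refl))) = ⊥-elim (<⇒≱ m+q<m+m u≤m+q)

  matching-degree-second-half : ∀ u → m + q + b < u → u ≤ m + k → degreeIn Matching? u ≡ 1
  matching-degree-second-half u m+q+b<u u≤m+k = card-singleton N w (Matching? u) w<N only (bwd (inj₁ (m<w , w≤m+q , u≡w+q+b)))
    where
    w = u ∸ (q + b)
    q+b≤u : q + b ≤ u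
    q+b≤u = ≤-trans (m≤n+m (q + b) m) (≤-trans (≤-reflexive (sym (+-assoc m q b))) (<⇒≤ m+q+b<u))
    w+q+b≡u : w + (q + b) ≡ u
    w+q+b≡u = m∸n+n≡m q+b≤u
    u≡w+q+b : u ≡ w + q + b
    u≡w+q+b = sym (trans (+-assoc w q b) w+q+b≡u)
    m<w : m < w
    m<w = +-cancelʳ-≤ (q + b) (suc m) w (≤-trans (≤-reflexive (cong suc (sym (+-assoc m q b)))) (≤-trans m+q+b<u (≤-reflexive (sym w+q+b≡u))))
    w≤m+q : w ≤ m + q
    w≤m+q = +-cancelʳ-≤ (q + b) w (m + q) (≤-trans (≤-reflexive w+q+b≡u)
              (≤-trans u≤m+k (≤-reflexive (trans (cong (m +_) (sym q+q+b≡k)) (sym (+-assoc m q (q + b)))))))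
    w<N : w < N
    w<N = ≤-<-trans (≤-trans (m∸n≤m u (q + b)) u≤m+k) m+k<N
    m+q<u : m + q < u
    m+q<u = ≤-<-trans (m≤m+n (m + q) b) m+q+b<u
    only : ∀ v → Matching u v → v ≡ w
    only v (fwd (inj₁ (_ , u≤m+q , _))) = ⊥-elim (<⇒≱ m+q<u u≤m+q)
    only v (fwd (inj₂ (b≡1 , refl , _))) = ⊥-elim (<⇒≱ m+q+b<u (≤-reflexive (sym (trans (cong (m + q +_) b≡1) (+-comm (m + q) 1)))))
    only v (bwd (inj₁ (_ , _ , u≡))) = trans (sym (m+n∸n≡m v (q + b))) (cong (_∸ (q + b)) (trans (sym (+-assoc v q b)) (sym u≡)))
    only v (bwd (inj₂ (_ , _ , refl))) = ⊥-elim (<⇒≱ m+k<m+m u≤m+k)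

  matching-degree-gap : b ≡ 1 → degreeIn Matching? (suc (m + q)) ≡ 1
  matching-degree-gap b≡1 = card-singleton N (m + m) (Matching? _) (n<1+n _) only (fwd (inj₂ (b≡1 , refl , refl)))
    where
    only : ∀ v → Matching (suc (m + q)) v → v ≡ m + m
    only v (fwd (inj₁ (_ , 1+m+q≤m+q , _))) = ⊥-elim (<⇒≱ (n<1+n _) 1+m+q≤m+q)
    only v (fwd (inj₂ (_ , _ , v≡))) = v≡
    only v (bwd (inj₁ (m<v , _ , e))) = ⊥-elim (<-irrefl e (≤-trans (s≤s (+-monoˡ-≤ q m<v))
                                          (≤-reflexive (trans (+-comm 1 (v + q)) (cong ((v + q) +_) (sym b≡1))))))
    only v (bwd (inj₂ (_ , _ , e))) = ⊥-elim (<-irrefl e 1+m+q<m+m)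

  matching-degree-upper : ∀ u → m < u → u ≤ m + k → degreeIn Matching? u ≡ 1
  matching-degree-upper u m<u u≤m+k with u ≤? m + q | m + q + b <? u
  ... | yes u≤m+q | _ = matching-degree-first-half u m<u u≤m+q
  ... | no _ | yes m+q+b<u = matching-degree-second-half u m+q+b<u u≤m+k
  ... | no u≰m+q | no m+q+b≮u = subst (λ x → degreeIn Matching? x ≡ 1) (sym u≡1+m+q) (matching-degree-gap b≡1)
    where
    b≡1 : b ≡ 1
    b≡1 = ≤-antisym b≤1 (+-cancelˡ-≤ (m + q) 1 b (≤-trans (≤-reflexive (+-comm (m + q) 1)) (≤-trans (≰⇒> u≰m+q) (≮⇒≥ m+q+b≮u))))
    u≡1+m+q : u ≡ suc (m + q)
    u≡1+m+q = ≤-antisym (≤-trans (≮⇒≥ m+q+b≮u) (≤-reflexive (trans (cong (m + q +_) b≡1) (+-comm (m + q) 1)))) (≰⇒> u≰m+q)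

  matching-degree-outer : ∀ u → ¬ (m < u × u ≤ m + k) → u ≢ m + m → degreeIn Matching? u ≡ 0
  matching-degree-outer u outside u≢m+m = card-∅ N (Matching? u) none
    where
    none : ∀ v → ¬ Matching u v
    none v (fwd (inj₁ (m<u , u≤m+q , _))) = outside (m<u , ≤-trans u≤m+q (+-monoʳ-≤ m q≤k))
    none v (fwd (inj₂ (b≡1 , refl , _))) = outside (s≤s (m≤m+n m q) , ≤-trans (≤-reflexive (sym (+-suc m q)))
      (+-monoʳ-≤ m (≤-trans (≤-reflexive (trans (+-comm 1 q) (cong (q +_) (sym b≡1))))
                            (≤-trans (+-monoˡ-≤ b (m≤n+m q q)) (≤-reflexive (sym p+a≡q+q+b))))))
    none v (bwd (inj₁ (m<v , v≤m+q , refl))) = outside (≤-trans m<v (≤-trans (m≤m+n v q) (m≤m+n (v + q) b)) , partner≤m+k v v≤m+q)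
    none v (bwd (inj₂ (_ , _ , u≡m+m))) = u≢m+m u≡m+m

  matching-degree-last : degreeIn Matching? (m + m) ≡ b
  matching-degree-last with m≤n⇒m<n∨m≡n b≤1
  ... | inj₂ refl = card-singleton N (suc (m + q)) (Matching? (m + m)) (s≤s (<⇒≤ 1+m+q<m+m)) only (bwd (inj₂ (refl , refl , refl)))
    where
    only : ∀ v → Matching (m + m) v → v ≡ suc (m + q)
    only v (fwd (inj₁ (_ , m+m≤m+q , _))) = ⊥-elim (<⇒≱ m+q<m+m m+m≤m+q)
    only v (fwd (inj₂ (_ , m+m≡ , _))) = ⊥-elim (<-irrefl (sym m+m≡) 1+m+q<m+m)
    only v (bwd (inj₁ (_ , v≤m+q , m+m≡))) = ⊥-elim (<⇒≱ m+k<m+m (≤-trans (≤-reflexive m+m≡) (partner≤m+k v v≤m+q)))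
    only v (bwd (inj₂ (_ , v≡ , _))) = v≡
  ... | inj₁ (s≤s z≤n) = card-∅ N (Matching? (m + m)) none
    where
    none : ∀ v → ¬ Matching (m + m) v
    none v (fwd (inj₁ (_ , m+m≤m+q , _))) = <⇒≱ m+q<m+m m+m≤m+q
    none v (fwd (inj₂ (() , _)))
    none v (bwd (inj₁ (_ , v≤m+q , m+m≡))) = <⇒≱ m+k<m+m (≤-trans (≤-reflexive m+m≡) (partner≤m+k v v≤m+q))
    none v (bwd (inj₂ (() , _)))

  m<m+m : m < m + m
  m<m+m = m<m+n m (≤-trans (s≤s z≤n) 5≤m)

  apex-degree : degree 0 + h + a ≡ m + m + p
  apex-degree = begin
    degree 0 + h + a                ≡⟨ cong₂ (λ x y → degree 0 + x + y) (sym #A+p≡h) (sym #U≡a) ⟩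
    degree 0 + (#A + p) + #U        ≡⟨ rearrange (degree 0) #A #U p ⟩
    degree 0 + (0 + (#A + #U)) + p  ≡⟨ cong (λ x → degree 0 + (x + (#A + #U)) + p) lowCut-degree-0 ⟨
    degree 0 + (#L + (#A + #U)) + p ≡⟨ cong (_+ p) (degree-balance 0) ⟩
    #T + #M + p                     ≡⟨ cong (λ x → #T + x + p) #M≡0 ⟩
    #T + 0 + p                      ≡⟨ cong (_+ p) (threshold-degree-≤m 0 z≤n) ⟩
    m + m + p                       ∎
    where
    open ≡-Reasoning
    #L = degreeIn LowCut? 0
    #A = degreeIn ApexCut? 0
    #U = degreeIn UpperCut? 0
    #T = degreeIn Threshold? 0
    #M = degreeIn Matching? 0
    rearrange : ∀ d x y p → d + (x + p) + y ≡ d + (0 + (x + y)) + p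
    rearrange = solve-∀
    #A+p≡h : #A + p ≡ h
    #A+p≡h = suc-injective (trans (sym (+-suc #A p)) apexCut-degree-0)
    #U≡a : #U ≡ a
    #U≡a = +-cancelʳ-≡ (m + p) #U a (trans (suc-injective (trans (sym (+-suc #U (m + p))) upperCut-degree-0))
                                           (trans (sym (+-assoc m p a)) (+-comm (m + p) a)))
    #M≡0 : #M ≡ 0
    #M≡0 = matching-degree-outer 0 (λ (m<0 , _) → n≮0 m<0) (λ 0≡m+m → n≮0 (subst (m <_) (sym 0≡m+m) m<m+m))

  surplus-cut : ∀ u → 1 ≤ u → u ≤ h → degreeIn ApexCut? u + degreeIn UpperCut? u ≡ 1
  surplus-cut u 1≤u u≤h with u ≤? p
  ... | yes u≤p = cong₂ _+_ (apexCut-degree-outer u (n>0⇒n≢0 1≤u) λ (p<u , _) → <⇒≱ p<u u≤p)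
                            (upperCut-degree-≤p u 1≤u u≤p)
  ... | no u≰p = cong₂ _+_ (apexCut-degree-inner u (≰⇒> u≰p) u≤h)
                           (upperCut-degree-outer u (n>0⇒n≢0 1≤u) u≰p λ (m<u , _) → <⇒≱ m<u (≤-trans u≤h h≤m))

  no-surplus-cut : ∀ u → h < u → u ≤ m → degreeIn ApexCut? u + degreeIn UpperCut? u ≡ 0
  no-surplus-cut u h<u u≤m = cong₂ _+_ (apexCut-degree-outer u u≢0 λ (_ , u≤h) → <⇒≱ h<u u≤h)
                                       (upperCut-degree-outer u u≢0 (λ u≤p → <⇒≱ h<u (≤-trans u≤p p≤h)) λ (m<u , _) → <⇒≱ m<u u≤m)
    where
    u≢0 = m<n⇒n≢0 h<u

  middle-cuts : ∀ u → 1 ≤ u → u ≤ m →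
    degreeIn LowCut? u + (degreeIn ApexCut? u + degreeIn UpperCut? u) + u ≡ m
  middle-cuts u 1≤u u≤m with u ≤? h
  ... | yes u≤h = trans (cong (λ x → degreeIn LowCut? u + x + u) (surplus-cut u 1≤u u≤h))
                        (lowCut-degree-≤h u 1≤u (≤-trans (+-mono-≤ u≤h u≤h) h+h≤m))
  ... | no u≰h = trans (cong (λ x → degreeIn LowCut? u + x + u) (no-surplus-cut u (≰⇒> u≰h) u≤m))
                       (trans (cong (_+ u) (+-identityʳ _)) (lowCut-degree->h u 1≤u u≤m m<u+u))
    where
    m<u+u : m < u + u
    m<u+u = ≤-trans (s≤s m≤1+h+h) (≤-trans (≤-reflexive (cong suc (sym (+-suc h h)))) (+-mono-≤ (≰⇒> u≰h) (≰⇒> u≰h)))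

  middle-degree : ∀ u → 1 ≤ u → u ≤ m → degree u ≡ m
  middle-degree u 1≤u u≤m = +-cancelʳ-≡ m (degree u) m (begin
    degree u + m                      ≡⟨ cong (degree u +_) (middle-cuts u 1≤u u≤m) ⟨
    degree u + (#cuts + u)            ≡⟨ +-assoc (degree u) #cuts u ⟨
    degree u + #cuts + u              ≡⟨ cong (_+ u) (degree-balance u) ⟩
    degreeIn Threshold? u + #M + u    ≡⟨ cong (λ x → degreeIn Threshold? u + x + u) #M≡0 ⟩
    degreeIn Threshold? u + 0 + u     ≡⟨ cong (_+ u) (+-identityʳ _) ⟩
    degreeIn Threshold? u + u         ≡⟨ threshold-degree-≤m u u≤m ⟩
    m + m                             ∎)
    where
    open ≡-Reasoning
    #cuts = degreeIn LowCut? u + (degreeIn ApexCut? u + degreeIn UpperCut? u)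
    #M = degreeIn Matching? u
    #M≡0 : #M ≡ 0
    #M≡0 = matching-degree-outer u (λ (m<u , _) → <⇒≱ m<u u≤m) (λ u≡m+m → <⇒≱ m<m+m (subst (_≤ m) u≡m+m u≤m))

  upperCut≡matching : ∀ u → m < u → u < m + m → degreeIn UpperCut? u ≡ degreeIn Matching? u
  upperCut≡matching u m<u u<m+m with u ≤? m + k
  ... | yes u≤m+k = trans (upperCut-degree-upper u m<u u≤m+k) (sym (matching-degree-upper u m<u u≤m+k))
  ... | no u≰m+k = trans (upperCut-degree-outer u (m<n⇒n≢0 m<u) (λ u≤p → <⇒≱ m<u (≤-trans u≤p (<⇒≤ p<m)))
                                                 λ (_ , u≤m+k) → u≰m+k u≤m+k)
                         (sym (matching-degree-outer u (λ (_ , u≤m+k) → u≰m+k u≤m+k) λ { refl → n≮n _ u<m+m }))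

  upper-degree : ∀ u → m < u → u < m + m → degree u + u ≡ N
  upper-degree u m<u u<m+m = trans (cong (_+ u) degree≡threshold) (threshold-degree->m u m<u (<⇒≤ u<m+m))
    where
    #U = degreeIn UpperCut? u
    #L≡0 = lowCut-degree->m u m<u
    #A≡0 = apexCut-degree-outer u (m<n⇒n≢0 m<u) λ (_ , u≤h) → <⇒≱ m<u (≤-trans u≤h h≤m)
    degree≡threshold : degree u ≡ degreeIn Threshold? u
    degree≡threshold = +-cancelʳ-≡ #U _ _ (begin
      degree u + #U                                        ≡⟨ cong (λ x → degree u + (x + (0 + #U))) #L≡0 ⟨
      degree u + (degreeIn LowCut? u + (0 + #U))           ≡⟨ cong (λ x → degree u + (degreeIn LowCut? u + (x + #U))) #A≡0 ⟨
      degree u + (degreeIn LowCut? u + (degreeIn ApexCut? u + #U)) ≡⟨ degree-balance u ⟩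
      degreeIn Threshold? u + degreeIn Matching? u          ≡⟨ cong (degreeIn Threshold? u +_) (upperCut≡matching u m<u u<m+m) ⟨
      degreeIn Threshold? u + #U                           ∎)
      where open ≡-Reasoning

  last-degree : degree (m + m) ≡ suc b
  last-degree = begin
    degree (m + m)                                          ≡⟨ +-identityʳ _ ⟨
    degree (m + m) + 0                                      ≡⟨ cong (λ x → degree (m + m) + (x + (0 + 0))) #L≡0 ⟨
    degree (m + m) + (#L + (0 + 0))                         ≡⟨ cong₂ (λ x y → degree (m + m) + (#L + (x + y))) #A≡0 #U≡0 ⟨
    degree (m + m) + (#L + (degreeIn ApexCut? (m + m) + degreeIn UpperCut? (m + m))) ≡⟨ degree-balance (m + m) ⟩
    degreeIn Threshold? (m + m) + degreeIn Matching? (m + m) ≡⟨ cong₂ _+_ #T≡1 matching-degree-last ⟩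
    suc b                                                   ∎
    where
    open ≡-Reasoning
    m+m≢0 : m + m ≢ 0
    m+m≢0 e = n≮0 (subst (m <_) e m<m+m)
    #L = degreeIn LowCut? (m + m)
    #L≡0 = lowCut-degree->m (m + m) m<m+m
    #A≡0 = apexCut-degree-outer (m + m) m+m≢0 λ (_ , m+m≤h) → <⇒≱ m<m+m (≤-trans m+m≤h h≤m)
    #U≡0 = upperCut-degree-outer (m + m) m+m≢0 (λ m+m≤p → <⇒≱ m<m+m (≤-trans m+m≤p (<⇒≤ p<m)))
                                 λ (_ , m+m≤m+k) → <⇒≱ m+k<m+m m+m≤m+k
    #T≡1 : degreeIn Threshold? (m + m) ≡ 1
    #T≡1 = +-cancelʳ-≡ (m + m) _ 1 (threshold-degree->m (m + m) m<m+m ≤-refl)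

  -- The zigzag path and its cycles

  kept-edge : ∀ {u v} → Threshold u v → ¬ LowCut u v → ¬ ApexCut u v → ¬ UpperCut u v → Edge u v
  kept-edge t ¬low ¬apex ¬upper = inj₁ (t , λ { (inj₁ c) → ¬low c ; (inj₂ (inj₁ c)) → ¬apex c ; (inj₂ (inj₂ c)) → ¬upper c })

  nonzero⇒¬ApexCut : ∀ {u v} → 1 ≤ u → 1 ≤ v → ¬ ApexCut u v
  nonzero⇒¬ApexCut 1≤u _ (fwd (refl , _)) = <⇒≱ 1≤u z≤n
  nonzero⇒¬ApexCut _ 1≤v (bwd (refl , _)) = <⇒≱ 1≤v z≤n

  large-sum⇒¬LowCut : ∀ {u v} → m < u + v → ¬ LowCut u v
  large-sum⇒¬LowCut m<u+v (_ , _ , u+v≤m , _) = <⇒≱ m<u+v u+v≤m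

  apex-edge : ∀ v → h < v → v ≤ m ⊎ m + k < v → v ≤ m + m → Edge 0 v
  apex-edge v h<v v∉tokens v≤m+m = kept-edge (v≤m+m , λ { refl → n≮0 h<v }) (λ (1≤0 , _) → <⇒≱ 1≤0 z≤n) ¬apex ¬upper
    where
    ¬apex : ¬ ApexCut 0 v
    ¬apex (fwd (_ , _ , v≤h)) = <⇒≱ h<v v≤h
    ¬apex (bwd (refl , _)) = n≮0 h<v
    ¬upper : ¬ UpperCut 0 v
    ¬upper (fwd (inj₁ (1≤0 , _))) = <⇒≱ 1≤0 z≤n
    ¬upper (fwd (inj₂ (_ , m+p<v , v≤m+k))) =
      [ (λ v≤m → <⇒≱ m+p<v (≤-trans v≤m (m≤m+n m p))) , (λ m+k<v → <⇒≱ m+k<v v≤m+k) ]′ v∉tokens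
    ¬upper (bwd (inj₁ (_ , v≤p , _))) = <⇒≱ h<v (≤-trans v≤p p≤h)
    ¬upper (bwd (inj₂ (refl , _))) = n≮0 h<v

  middle-edge : ∀ u v → 1 ≤ u → 1 ≤ v → u ≤ m → v ≤ m → m < u + v → u ≢ v → Edge u v
  middle-edge u v 1≤u 1≤v u≤m v≤m m<u+v u≢v =
    kept-edge (+-mono-≤ u≤m v≤m , u≢v) (large-sum⇒¬LowCut m<u+v) (nonzero⇒¬ApexCut 1≤u 1≤v) ¬upper
    where
    partner-too-small : ∀ {x y} → x ≤ p → y ≤ m → x + y ≢ suc (m + p)
    partner-too-small x≤p y≤m e = <-irrefl e (s≤s (≤-trans (+-mono-≤ x≤p y≤m) (≤-reflexive (+-comm p m))))
    ¬upper : ¬ UpperCut u v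
    ¬upper (fwd (inj₁ (_ , u≤p , e))) = partner-too-small u≤p v≤m e
    ¬upper (fwd (inj₂ (refl , _))) = <⇒≱ 1≤u z≤n
    ¬upper (bwd (inj₁ (_ , v≤p , e))) = partner-too-small v≤p u≤m e
    ¬upper (bwd (inj₂ (refl , _))) = <⇒≱ 1≤v z≤n

  long-edge : ∀ u v → 1 ≤ u → 1 ≤ v → suc (m + p) < u + v → u + v ≤ m + m → u ≢ v → Edge u v
  long-edge u v 1≤u 1≤v long u+v≤ u≢v =
    kept-edge (u+v≤ , u≢v) (large-sum⇒¬LowCut (≤-<-trans (n≤1+n _) (≤-<-trans (s≤s (m≤m+n m p)) long)))
              (nonzero⇒¬ApexCut 1≤u 1≤v) ¬upper
    where
    ¬upper : ¬ UpperCut u v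
    ¬upper (fwd (inj₁ (_ , _ , e))) = <-irrefl (sym e) long
    ¬upper (fwd (inj₂ (refl , _))) = <⇒≱ 1≤u z≤n
    ¬upper (bwd (inj₁ (_ , _ , e))) = <-irrefl (sym (trans (+-comm u v) e)) long
    ¬upper (bwd (inj₂ (refl , _))) = <⇒≱ 1≤v z≤n

  p+3≤m : p + 3 ≤ m
  p+3≤m = ≤-trans (+-monoˡ-≤ 3 p≤h) h+3≤m

  private
    shift₂ : ∀ x y → suc (suc (x + y)) ≡ x + (y + 2)
    shift₂ = solve-∀

    shift₃ : ∀ x y → suc (suc (suc (x + y))) ≡ x + (y + 3)
    shift₃ = solve-∀

  m+p+2≤m+m : suc (suc (m + p)) ≤ m + m
  m+p+2≤m+m = ≤-trans (≤-reflexive (shift₂ m p)) (+-monoʳ-≤ m (≤-trans (+-monoʳ-≤ p (n≤1+n 2)) p+3≤m))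

  edge-across-odd : ∀ i j → suc (i + j) ≡ m + m → i < m → Edge i j
  edge-across-odd zero j e 0<m = apex-edge j (<-≤-trans h<m m≤j) (inj₂ m+k<j) (≤-trans (n≤1+n j) (≤-reflexive e))
    where
    m≤j : m ≤ j
    m≤j = ≮⇒≥ λ j<m → <-irrefl e (+-mono-≤ 0<m j<m)
    m+k<j : m + k < j
    m+k<j = ≤-pred (≤-trans (≤-reflexive (shift₂ m k)) (≤-trans (+-monoʳ-≤ m k+2≤m) (≤-reflexive (sym e))))
  edge-across-odd (suc i′) j e i<m =
    long-edge (suc i′) j (s≤s z≤n) (≤-trans (s≤s z≤n) (≤-trans 5≤m m≤j)) long (≤-trans (n≤1+n _) (≤-reflexive e))
              (λ { refl → <⇒≱ i<m m≤j })
    where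
    m≤j : m ≤ j
    m≤j = ≮⇒≥ λ j<m → <-irrefl e (≤-trans (≤-reflexive (cong suc (sym (+-suc (suc i′) j)))) (+-mono-≤ i<m j<m))
    long : suc (m + p) < suc i′ + j
    long = ≤-pred (≤-trans (≤-reflexive (shift₃ m p)) (≤-trans (+-monoʳ-≤ m p+3≤m) (≤-reflexive (sym e))))

  edge-across-even : ∀ i j → i + j ≡ m + m → 1 ≤ i → i < m → Edge j i
  edge-across-even i j e 1≤i i<m =
    long-edge j i (≤-trans (s≤s z≤n) m<j) 1≤i (≤-trans m+p+2≤m+m (≤-reflexive (trans (sym e) (+-comm i j))))
              (≤-reflexive (trans (+-comm j i) e)) (λ { refl → <⇒≱ m<j (<⇒≤ i<m) })
    where
    m<j : m < j
    m<j = ≰⇒> λ j≤m → <-irrefl e (+-mono-<-≤ i<m j≤m)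

  zigzag : ℕ → ℕ
  zigzag j with parity j
  ... | 0ℙ = ⌊ j /2⌋
  ... | 1ℙ = m + m ∸ suc ⌊ j /2⌋

  parity-double : ∀ i → parity (i + i) ≡ 0ℙ
  parity-double zero = refl
  parity-double (suc i) rewrite +-suc i i = parity-double i

  parity-double+1 : ∀ i → parity (suc (i + i)) ≡ 1ℙ
  parity-double+1 zero = refl
  parity-double+1 (suc i) rewrite +-suc i i = parity-double+1 i

  zigzag-even : ∀ i → zigzag (i + i) ≡ i
  zigzag-even i rewrite parity-double i = sym (n≡⌊n+n/2⌋ i)

  zigzag-odd : ∀ i → zigzag (suc (i + i)) ≡ m + m ∸ suc i
  zigzag-odd i rewrite parity-double+1 i = cong (λ x → m + m ∸ suc x) (sym (n≡⌈n+n/2⌉ i))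

  half<m : ∀ {i} → i + i < m + m → i < m
  half<m lt = ≰⇒> λ m≤i → <⇒≱ lt (+-mono-≤ m≤i m≤i)

  zigzag-edge : ∀ j → suc j < m + m → Edge (zigzag j) (zigzag (suc j))
  zigzag-edge j 1+j<m+m with even-or-odd j
  ... | i , inj₁ refl rewrite zigzag-even i | zigzag-odd i =
    edge-across-odd i (m + m ∸ suc i) (m+[n∸m]≡n (≤-trans (s≤s (m≤m+n i i)) (<⇒≤ 1+j<m+m))) (half<m (<-trans (n<1+n _) 1+j<m+m))
  ... | i , inj₂ refl rewrite zigzag-odd i | cong zigzag (cong suc (sym (+-suc i i))) | zigzag-even (suc i) =
    edge-across-even (suc i) (m + m ∸ suc i) (m+[n∸m]≡n (≤-trans (s≤s (m≤m+n i i)) (<⇒≤ (<-trans (n<1+n _) 1+j<m+m))))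
                     (s≤s z≤n) (half<m (subst (_< m + m) (cong suc (sym (+-suc i i))) 1+j<m+m))

  zigzag-even-<m : ∀ i → i + i < m + m → zigzag (i + i) < m
  zigzag-even-<m i lt = subst (_< m) (sym (zigzag-even i)) (half<m lt)

  zigzag-odd-≥m : ∀ i → suc (i + i) < m + m → m ≤ zigzag (suc (i + i))
  zigzag-odd-≥m i lt = subst (m ≤_) (sym (zigzag-odd i))
    (≤-trans (≤-reflexive (sym (m+n∸n≡m m m))) (∸-monoʳ-≤ (m + m) (half<m (<-trans (n<1+n _) lt))))

  zigzag-<m+m : ∀ j → j < m + m → zigzag j < m + m
  zigzag-<m+m j j<m+m with even-or-odd j
  ... | i , inj₁ refl = <-≤-trans (zigzag-even-<m i j<m+m) m≤m+m
  ... | i , inj₂ refl = subst (_< m + m) (sym (zigzag-odd i)) (∸-monoʳ-< (s≤s z≤n) (≤-trans (s≤s (m≤m+n i i)) (<⇒≤ j<m+m)))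

  zigzag-injective : ∀ j j′ → j < m + m → j′ < m + m → zigzag j ≡ zigzag j′ → j ≡ j′
  zigzag-injective j j′ j< j′< e with even-or-odd j | even-or-odd j′
  ... | i , inj₁ refl | i′ , inj₁ refl = cong (λ x → x + x) (trans (sym (zigzag-even i)) (trans e (zigzag-even i′)))
  ... | i , inj₂ refl | i′ , inj₂ refl = cong (λ x → suc (x + x)) (suc-injective
    (∸-cancelˡ-≡ (≤-trans (s≤s (m≤m+n i i)) (<⇒≤ j<)) (≤-trans (s≤s (m≤m+n i′ i′)) (<⇒≤ j′<))
                 (trans (sym (zigzag-odd i)) (trans e (zigzag-odd i′)))))
  ... | i , inj₁ refl | i′ , inj₂ refl = ⊥-elim (<⇒≱ (zigzag-even-<m i j<) (subst (m ≤_) (sym e) (zigzag-odd-≥m i′ j′<)))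
  ... | i , inj₂ refl | i′ , inj₁ refl = ⊥-elim (<⇒≱ (zigzag-even-<m i′ j′<) (subst (m ≤_) e (zigzag-odd-≥m i j<)))

  graph : SimpleGraph N
  graph = record
    { adj = λ x y → does (Edge? (toℕ x) (toℕ y))
    ; sym = λ x y → does-cong (Edge? (toℕ x) (toℕ y)) (Edge? (toℕ y) (toℕ x)) Edge-sym Edge-sym
    ; irrefl = λ x → dec-false (Edge? (toℕ x) (toℕ x)) Edge-irrefl
    }

  deg-graph : ∀ x → deg graph x ≡ degree (toℕ x)
  deg-graph x = listSum-allFin {N} (λ y → 𝟙 (Edge? (toℕ x) (toℕ y)))

  adjacent : ∀ x y → Edge (toℕ x) (toℕ y) → Adj graph x y
  adjacent x y = dec-true (Edge? (toℕ x) (toℕ y))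

  First : Fin N → Set
  First u = ∃ λ (j : Fin (m + m)) → inject₁ j ≡ u

  segment-cycle : ∀ s r e → s + r ≡ suc e → e < m + m → Edge (zigzag e) (zigzag s) → HasCycleIn graph First r
  segment-cycle s r e s+r≡1+e e<m+m chord = c , injective , first , consecutive , closing
    where
    bound : ∀ (i : Fin r) → s + toℕ i < m + m
    bound i = ≤-trans (+-monoʳ-< s (toℕ<n i)) (≤-trans (≤-reflexive s+r≡1+e) e<m+m)
    c : Fin r → Fin N
    c i = fromℕ< (<-trans (zigzag-<m+m _ (bound i)) (n<1+n _))
    toℕ-c : ∀ i → toℕ (c i) ≡ zigzag (s + toℕ i)
    toℕ-c i = toℕ-fromℕ< _
    injective : ∀ {i j} → c i ≡ c j → i ≡ j
    injective {i} {j} ci≡cj = toℕ-injective (+-cancelˡ-≡ s _ _ (zigzag-injective _ _ (bound i) (bound j)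
      (trans (sym (toℕ-c i)) (trans (cong toℕ ci≡cj) (toℕ-c j)))))
    first : ∀ i → First (c i)
    first i = fromℕ< (zigzag-<m+m _ (bound i)) , toℕ-injective (trans (toℕ-inject₁ _) (trans (toℕ-fromℕ< _) (sym (toℕ-c i))))
    consecutive : ∀ i j → suc (toℕ i) ≡ toℕ j → Adj graph (c i) (c j)
    consecutive i j 1+i≡j = adjacent (c i) (c j) (subst₂ Edge (sym (toℕ-c i)) (sym (trans (toℕ-c j) (cong zigzag next)))
      (zigzag-edge (s + toℕ i) (subst (_< m + m) next (bound j))))
      where
      next : s + toℕ j ≡ suc (s + toℕ i)
      next = trans (cong (s +_) (sym 1+i≡j)) (+-suc s (toℕ i))
    closing : ∀ i j → toℕ i ≡ r ∸ 1 → toℕ j ≡ 0 → Adj graph (c i) (c j)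
    closing i j i≡r-1 j≡0 = adjacent (c i) (c j) (subst₂ Edge (sym (trans (toℕ-c i) (cong zigzag last)))
      (sym (trans (toℕ-c j) (cong zigzag (trans (cong (s +_) j≡0) (+-identityʳ s))))) chord)
      where
      last : s + toℕ i ≡ e
      last = suc-injective (trans (sym (+-suc s (toℕ i))) (trans (cong (λ x → s + suc x) i≡r-1)
               (trans (cong (s +_) (trans (+-comm 1 (r ∸ 1)) (m∸n+n≡m (≤-trans (s≤s z≤n) (toℕ<n i))))) s+r≡1+e)))

  chord-edge : ∀ x w → h < x → x ≤ m → w < x → (1 ≤ w → m < x + w) → Edge x w
  chord-edge x zero h<x x≤m _ _ = Edge-sym (apex-edge x h<x (inj₁ x≤m) (≤-trans x≤m m≤m+m))
  chord-edge x (suc w) h<x x≤m w<x long =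
    middle-edge x (suc w) (≤-trans (s≤s z≤n) h<x) (s≤s z≤n) x≤m (≤-trans (<⇒≤ w<x) x≤m) (long (s≤s z≤n))
                (λ { refl → n≮n _ w<x })

  m′ : ℕ
  m′ = m ∸ 1

  1+m′≡m : suc m′ ≡ m
  1+m′≡m = trans (+-comm 1 m′) (m∸n+n≡m (≤-trans (s≤s z≤n) 5≤m))

  even-cycle : ∀ t → 2 ≤ t → t ≤ m → HasCycleIn graph First (t + t)
  even-cycle t 2≤t t≤m = segment-cycle (w + w) (t + t) (suc (m′ + m′)) s+r≡1+e (≤-reflexive (sym m+m≡)) chord
    where
    w = m ∸ t
    w+t≡m : w + t ≡ m
    w+t≡m = m∸n+n≡m t≤m
    m+m≡ : m + m ≡ suc (suc (m′ + m′))
    m+m≡ = trans (cong₂ _+_ (sym 1+m′≡m) (sym 1+m′≡m)) (cong suc (+-suc m′ m′))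
    s+r≡1+e : w + w + (t + t) ≡ suc (suc (m′ + m′))
    s+r≡1+e = trans (interchange w w t t) (trans (cong₂ _+_ w+t≡m w+t≡m) m+m≡)
      where
      interchange : ∀ a b c d → a + b + (c + d) ≡ (a + c) + (b + d)
      interchange = solve-∀
    zigzag-e : zigzag (suc (m′ + m′)) ≡ m
    zigzag-e = trans (zigzag-odd m′) (trans (cong (m + m ∸_) 1+m′≡m) (m+n∸n≡m m m))
    chord : Edge (zigzag (suc (m′ + m′))) (zigzag (w + w))
    chord = subst₂ Edge (sym zigzag-e) (sym (zigzag-even w))
      (chord-edge m w h<m ≤-refl (<-≤-trans (m<m+n w (≤-trans (s≤s z≤n) 2≤t)) (≤-reflexive w+t≡m)) (m<m+n m))

  -- For t = m − 2 the chord (m − 1, 1) used below would be a low cut, so that cycle starts at the apex instead.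
  odd-cycle : ∀ t → 1 ≤ t → t < m → HasCycleIn graph First (suc (t + t))
  odd-cycle t 1≤t t<m with t + 2 ≟ m
  ... | yes t+2≡m = segment-cycle 0 (suc (t + t)) (t + t) refl (+-mono-< t<m t<m)
    (subst (λ x → Edge x 0) (sym (zigzag-even t)) (chord-edge t 0 h<t (<⇒≤ t<m) 1≤t λ ()))
    where
    h<t : h < t
    h<t = +-cancelʳ-≤ 2 (suc h) t (≤-trans (≤-reflexive (sym (+-suc h 2))) (≤-trans h+3≤m (≤-reflexive (sym t+2≡m))))
  ... | no t+2≢m = segment-cycle (w + w) (suc (t + t)) (m′ + m′) s+r≡1+e m′+m′<m+m chord
    where
    t≤m′ : t ≤ m′
    t≤m′ = ≤-pred (≤-trans t<m (≤-reflexive (sym 1+m′≡m)))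
    w = m′ ∸ t
    w+t≡m′ : w + t ≡ m′
    w+t≡m′ = m∸n+n≡m t≤m′
    s+r≡1+e : w + w + suc (t + t) ≡ suc (m′ + m′)
    s+r≡1+e = trans (interchange w w t t) (cong suc (cong₂ _+_ w+t≡m′ w+t≡m′))
      where
      interchange : ∀ a b c d → a + b + suc (c + d) ≡ suc ((a + c) + (b + d))
      interchange = solve-∀
    m′≤m : m′ ≤ m
    m′≤m = ≤-trans (n≤1+n m′) (≤-reflexive 1+m′≡m)
    m′+m′<m+m : m′ + m′ < m + m
    m′+m′<m+m = +-mono-<-≤ (≤-reflexive 1+m′≡m) m′≤m
    h<m′ : h < m′
    h<m′ = ≤-trans (≤-trans (≤-reflexive (+-comm 1 h)) (+-monoʳ-≤ h (n≤1+n 1)))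
                   (≤-pred (≤-trans (≤-reflexive (sym (+-suc h 2))) (≤-trans h+3≤m (≤-reflexive (sym 1+m′≡m)))))
    w≢1 : w ≢ 1
    w≢1 w≡1 = t+2≢m (trans (+-comm t 2) (trans (cong suc (trans (cong (_+ t) (sym w≡1)) w+t≡m′)) 1+m′≡m))
    long : 1 ≤ w → m < m′ + w
    long 1≤w = ≤-trans (≤-reflexive (cong suc (sym 1+m′≡m)))
                       (≤-trans (≤-reflexive (+-comm 2 m′)) (+-monoʳ-≤ m′ (≤∧≢⇒< 1≤w (≢-sym w≢1))))
    chord : Edge (zigzag (m′ + m′)) (zigzag (w + w))
    chord = subst₂ Edge (sym (zigzag-even m′)) (sym (zigzag-even w))
      (chord-edge m′ w h<m′ m′≤m (<-≤-trans (m<m+n w 1≤t) (≤-reflexive w+t≡m′)) long)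

  cycles : ∀ r → 3 ≤ r → r ≤ m + m → HasCycleIn graph First r
  cycles r 3≤r r≤m+m with even-or-odd r
  ... | t , inj₁ refl = even-cycle t (two≤ t 3≤r) (≮⇒≥ λ m<t → <⇒≱ (+-mono-< m<t m<t) r≤m+m)
    where
    two≤ : ∀ t → 3 ≤ t + t → 2 ≤ t
    two≤ (suc (suc _)) _ = s≤s (s≤s z≤n)
    two≤ (suc zero) (s≤s (s≤s ()))
  ... | t , inj₂ refl = odd-cycle t (one≤ t 3≤r) (half<m r≤m+m)
    where
    one≤ : ∀ t → 3 ≤ suc (t + t) → 1 ≤ t
    one≤ (suc _) _ = s≤s z≤n
    one≤ zero (s≤s ())

apex-parameters : ∀ m h D → m ≤ D → D ≤ m + m → 2 ≤ h → h + 2 ≤ m →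
  ∃₂ λ p a → p ≤ h × p + a + 2 ≤ m × D + h + a ≡ m + m + p
apex-parameters m h D m≤D D≤m+m 2≤h h+2≤m with m + m ≤? D + h
... | yes m+m≤D+h = p , 0 , p≤h , ≤-trans (+-monoˡ-≤ 2 (≤-trans (≤-reflexive (+-identityʳ p)) p≤h)) h+2≤m , D+h+0≡
  where
  p = D + h ∸ (m + m)
  p+m+m≡D+h : p + (m + m) ≡ D + h
  p+m+m≡D+h = m∸n+n≡m m+m≤D+h
  p≤h : p ≤ h
  p≤h = +-cancelʳ-≤ (m + m) p h (≤-trans (≤-reflexive p+m+m≡D+h) (≤-trans (+-monoˡ-≤ h D≤m+m) (≤-reflexive (+-comm (m + m) h))))
  D+h+0≡ : D + h + 0 ≡ m + m + p
  D+h+0≡ = trans (+-identityʳ _) (trans (sym p+m+m≡D+h) (+-comm p (m + m)))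
... | no m+m≰D+h = 0 , a , z≤n , a+2≤m , trans D+h+a≡m+m (sym (+-identityʳ (m + m)))
  where
  a = m + m ∸ (D + h)
  D+h+a≡m+m : D + h + a ≡ m + m
  D+h+a≡m+m = m+[n∸m]≡n (<⇒≤ (≰⇒> m+m≰D+h))
  a+h≤m : a + h ≤ m
  a+h≤m = +-cancelˡ-≤ m (a + h) m (≤-trans (+-monoˡ-≤ (a + h) m≤D)
            (≤-reflexive (trans (cong (D +_) (+-comm a h)) (trans (sym (+-assoc D h a)) D+h+a≡m+m))))
  a+2≤m : 0 + a + 2 ≤ m
  a+2≤m = ≤-trans (+-monoʳ-≤ a 2≤h) a+h≤m

module DegreeProfile (m : ℕ) (d : Fin (suc (m + m)) → ℕ)
  (d-middle : ∀ (i : ℕ) → 2 ≤ i → i ≤ m + 2 → d at i ≡ m)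
  (d-tail : ∀ (i : ℕ) → 1 ≤ i → i ≤ m ∸ 2 → d at (suc (m + m) ∸ i) ≡ i + 1) where

  d-low : ∀ u → 1 ≤ u → u ≤ m → d at suc u ≡ m
  d-low u 1≤u u≤m = d-middle (suc u) (s≤s 1≤u) (≤-trans (s≤s u≤m) (≤-trans (n≤1+n _) (≤-reflexive (+-comm 2 m))))

  d-high : ∀ u → m < u → u < m + m → d at suc u + u ≡ suc (m + m)
  d-high u m<u u<m+m with u ≟ suc m
  ... | yes refl = trans (cong (_+ suc m) (d-middle (suc (suc m)) (s≤s (s≤s z≤n)) (≤-reflexive (+-comm 2 m)))) (+-suc m m)
  ... | no u≢1+m = trans (cong (_+ u) (trans (cong (d at_) (sym 1+m+m∸i≡1+u)) (trans (d-tail i 1≤i i≤m∸2) (+-comm i 1))))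
                         (cong suc i+u≡m+m)
    where
    i = m + m ∸ u
    i+u≡m+m : i + u ≡ m + m
    i+u≡m+m = m∸n+n≡m (<⇒≤ u<m+m)
    1≤i : 1 ≤ i
    1≤i = +-cancelʳ-≤ u 1 i (≤-trans u<m+m (≤-reflexive (sym i+u≡m+m)))
    i≤m∸2 : i ≤ m ∸ 2
    i≤m∸2 = ≤-trans (≤-reflexive (sym (m+n∸n≡m i 2))) (∸-monoˡ-≤ 2 (+-cancelʳ-≤ m (i + 2) m
              (≤-trans (≤-reflexive (shift i m)) (≤-trans (+-monoʳ-≤ i (≤∧≢⇒< m<u (≢-sym u≢1+m))) (≤-reflexive i+u≡m+m)))))
      where
      shift : ∀ i m → i + 2 + m ≡ i + suc (suc m)
      shift = solve-∀
    1+m+m∸i≡1+u : suc (m + m) ∸ i ≡ suc u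
    1+m+m∸i≡1+u = trans (+-∸-assoc 1 (≤-trans (m≤m+n i u) (≤-reflexive i+u≡m+m)))
                        (cong suc (trans (cong (_∸ i) (sym i+u≡m+m)) (m+n∸m≡n i u)))

half-bounds : ∀ {m h e} → 5 ≤ m → m ≡ h + h + e → e ≤ 1 → h + h ≤ m × m ≤ suc (h + h) × 2 ≤ h × h + 2 ≤ m
half-bounds {h = h} {e} 5≤m refl e≤1 = h+h≤m , m≤1+h+h , 2≤h h 5≤m , ≤-trans (+-monoʳ-≤ h (2≤h h 5≤m)) h+h≤m
  where
  h+h≤m : h + h ≤ h + h + e
  h+h≤m = m≤m+n (h + h) e
  m≤1+h+h : h + h + e ≤ suc (h + h)
  m≤1+h+h = ≤-trans (+-monoʳ-≤ (h + h) e≤1) (≤-reflexive (+-comm (h + h) 1))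
  2≤h : ∀ h → 5 ≤ h + h + e → 2 ≤ h
  2≤h (suc (suc _)) _ = s≤s (s≤s z≤n)
  2≤h 0 5≤e = ⊥-elim (<⇒≱ (≤-trans (s≤s (s≤s z≤n)) 5≤e) e≤1)
  2≤h 1 5≤2+e = ⊥-elim (<⇒≱ (≤-trans (s≤s (s≤s z≤n)) (≤-pred (≤-pred 5≤2+e))) e≤1)

first-entry-≥ : ∀ {x D m} → (x ≡ 2 × suc m ≤ D) ⊎ (x ≡ 1 × D ≡ m) → m ≤ D
first-entry-≥ (inj₁ (_ , m<D)) = <⇒≤ m<D
first-entry-≥ (inj₂ (_ , D≡m)) = ≤-reflexive (sym D≡m)

last-entry-∈[1,2] : ∀ {x D m} → (x ≡ 2 × suc m ≤ D) ⊎ (x ≡ 1 × D ≡ m) → 1 ≤ x × x ≤ 2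
last-entry-∈[1,2] (inj₁ (refl , _)) = s≤s z≤n , ≤-refl
last-entry-∈[1,2] (inj₂ (refl , _)) = ≤-refl , s≤s z≤n

module Realization (m h p a q b : ℕ) (5≤m : 5 ≤ m) (h+h≤m : h + h ≤ m) (m≤1+h+h : m ≤ suc (h + h))
  (p≤h : p ≤ h) (p+a+2≤m : p + a + 2 ≤ m) (p+a≡q+q+b : p + a ≡ q + q + b) (b≤1 : b ≤ 1)
  (d : Fin (suc (m + m)) → ℕ) (graphic : Graphic d)
  (d-middle : ∀ (i : ℕ) → 2 ≤ i → i ≤ m + 2 → d at i ≡ m)
  (d-tail : ∀ (i : ℕ) → 1 ≤ i → i ≤ m ∸ 2 → d at (suc (m + m) ∸ i) ≡ i + 1)
  (apex-eq : d at 1 + h + a ≡ m + m + p) (last-∈[1,2] : 1 ≤ d at suc (m + m) × d at suc (m + m) ≤ 2) where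

  open Construction m h p a q b 5≤m h+h≤m m≤1+h+h p≤h p+a+2≤m p+a≡q+q+b b≤1
  open DegreeProfile m d d-middle d-tail

  degree-below : ∀ u → u < m + m → degree u ≡ d at suc u
  degree-below zero _ = +-cancelʳ-≡ h _ _ (+-cancelʳ-≡ a _ _ (trans apex-degree (sym apex-eq)))
  degree-below u@(suc _) u<m+m with u ≤? m
  ... | yes u≤m = trans (middle-degree u (s≤s z≤n) u≤m) (sym (d-low u (s≤s z≤n) u≤m))
  ... | no u≰m = +-cancelʳ-≡ u _ _ (trans (upper-degree u (≰⇒> u≰m) u<m+m) (sym (d-high u (≰⇒> u≰m) u<m+m)))

  deg-below : ∀ (x : Fin (suc (m + m))) → toℕ x < m + m → deg graph x ≡ d x
  deg-below x x<m+m = trans (deg-graph x) (trans (degree-below (toℕ x) x<m+m) (at-suc-toℕ d x))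

  deg-last : deg graph (fromℕ (m + m)) ≡ d (fromℕ (m + m))
  deg-last = last-entry-by-parity (deg graph) d (λ i → deg-below (inject₁ i) (subst (_< m + m) (sym (toℕ-inject₁ i)) (toℕ<n i)))
    (deg-sum-even graph) (graphic-sum-even graphic)
    (subst (1 ≤_) (sym deg≡) (s≤s z≤n)) (subst (_≤ 2) (sym deg≡) (s≤s b≤1))
    (subst (1 ≤_) d≡ (proj₁ last-∈[1,2])) (subst (_≤ 2) d≡ (proj₂ last-∈[1,2]))
    where
    deg≡ : deg graph (fromℕ (m + m)) ≡ suc b
    deg≡ = trans (deg-graph (fromℕ (m + m))) (trans (cong degree (toℕ-fromℕ (m + m))) last-degree)
    d≡ : d at suc (m + m) ≡ d (fromℕ (m + m))
    d≡ = trans (cong (λ x → d at suc x) (sym (toℕ-fromℕ (m + m)))) (at-suc-toℕ d _)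

  realization : IsRealization graph d
  realization x with toℕ x <? m + m
  ... | yes x<m+m = deg-below x x<m+m
  ... | no x≮m+m rewrite toℕ≮n⇒fromℕ x x≮m+m = deg-last

  cycles-on-first : HasCyclesOnFirst d (m + m)
  cycles-on-first = graph , realization , inject₁ , inject₁-injective , first-degrees , cycles
    where
    first-degrees : ∀ (j : Fin (m + m)) → deg graph (inject₁ j) ≡ d at suc (toℕ j)
    first-degrees j = trans (realization (inject₁ j))
                            (trans (sym (at-suc-toℕ d (inject₁ j))) (cong (λ x → d at suc x) (toℕ-inject₁ j)))

-- Generalised over n ≡ m + m because 2 * m reduces to m + (m + 0), not to m + m.
realization-with-cycles : (m : ℕ) → 5 ≤ m → (n : ℕ) → n ≡ m + m → (d : Fin (suc n) → ℕ) →
  InGS (suc n) d →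
  (∀ (i : ℕ) → 2 ≤ i → i ≤ m + 2 → d at i ≡ m) →
  (∀ (i : ℕ) → 1 ≤ i → i ≤ m ∸ 2 → d at (suc n ∸ i) ≡ i + 1) →
  ((d at suc n ≡ 2 × suc m ≤ d at 1) ⊎ (d at suc n ≡ 1 × d at 1 ≡ m)) →
  HasCyclesOnFirst d n
realization-with-cycles m 5≤m .(m + m) refl d (graphic , _ , d≤m+m) d-middle d-tail ends with halve m
... | h , e , m≡h+h+e , e≤1 with half-bounds 5≤m m≡h+h+e e≤1
... | h+h≤m , m≤1+h+h , 2≤h , h+2≤m
  with apex-parameters m h (d at 1) (first-entry-≥ ends) (subst (_≤ m + m) (sym (at-suc d 0 (s≤s z≤n))) (d≤m+m _))
                       2≤h h+2≤m
... | p , a , p≤h , p+a+2≤m , apex-eq with halve (p + a)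
... | q , b , p+a≡q+q+b , b≤1 =
  Realization.cycles-on-first m h p a q b 5≤m h+h≤m m≤1+h+h p≤h p+a+2≤m p+a≡q+q+b b≤1
    d graphic d-middle d-tail apex-eq (last-entry-∈[1,2] ends)

lemma2p6 : (m : ℕ) → 5 ≤ m → (d : Fin (suc (2 * m)) → ℕ) →
    InGS (suc (2 * m)) d →
    (∀ (i : ℕ) → 2 ≤ i → i ≤ m + 2 → d at i ≡ m) →
    (∀ (i : ℕ) → 1 ≤ i → i ≤ m ∸ 2 → d at (suc (2 * m) ∸ i) ≡ i + 1) →
    ((d at suc (2 * m) ≡ 2 × suc m ≤ d at 1) ⊎ (d at suc (2 * m) ≡ 1 × d at 1 ≡ m)) →
    HasCyclesOnFirst d (2 * m)
lemma2p6 m 5≤m = realization-with-cycles m 5≤m (2 * m) (cong (m +_) (+-identityʳ m))
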